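{- Let $\Sigma$ be any subexponential signature, let $\Pi=A_1,\dots,A_k$ be a (possibly empty) sequence of formulae of $\mathrm{SMALC}_\Sigma$ and $B$ a formula of $\mathrm{SMALC}_\Sigma$. The following are equivalent: (1) $\Pi\to B$ is derivable in $\mathrm{SMALC}_\Sigma$; (2) $\Pi\to B$ is derivable in $\mathrm{SMALC}_\Sigma+(\mathrm{cut})$; (3) $\vdash\widehat{\Pi}^\bot,\widehat{B}$ is derivable in $\mathrm{SCLL}_\Sigma+(\mathrm{cut})$; (4) $\vdash\widehat{\Pi}^\bot,\widehat{B}$ is derivable in $\mathrm{SCLL}_\Sigma$.
   Context: A subexponential signature is a tuple $\Sigma = \langle \mathcal{I}, \preceq, \mathcal{W}, \mathcal{C}, \mathcal{E}\rangle$ where $\mathcal{I}$ is a finite set of labels, $\preceq$ is a preorder on $\mathcal{I}$, and $\mathcal{W},\mathcal{C},\mathcal{E}\subseteq\mathcal{I}$ are upwardly closed with respect to $\preceq$, and $\mathcal{W}\cap\mathcal{C}\subseteq\mathcal{E}$. The multiplicative-additive Lambek calculus with subexponentials, $\mathrm{SMALC}_\Sigma$. Formulae are built from variables $p_1,p_2,\dots$ and the constant $\mathbf{1}$ using binary connectives $\cdot$, $\backslash$, $/$, $\wedge$, $\vee$ and unary ${!}^s$ for $s\in\mathcal{I}$. Sequents are $\Gamma\to C$ with $\Gamma$ a finite, possibly empty, sequence of formulae. Axioms and rules (cut-free): (ax) $A\to A$; ($\to\mathbf{1}$) $\to\mathbf{1}$; ($\cdot\to$) from $\Gamma_1,A,B,\Gamma_2\to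 C$ infer $\Gamma_1,A\cdot B,\Gamma_2\to C$; ($\to\cdot$) from $\Gamma_1\to A$ and $\Gamma_2\to B$ infer $\Gamma_1,\Gamma_2\to A\cdot B$; ($\backslash\to$) from $\Pi\to A$ and $\Gamma_1,B,\Gamma_2\to C$ infer $\Gamma_1,\Pi,A\backslash B,\Gamma_2\to C$; ($\to\backslash$) from $A,\Pi\to B$ infer $\Pi\to A\backslash B$; ($/\to$) from $\Pi\to A$ and $\Gamma_1,B,\Gamma_2\to C$ infer $\Gamma_1,B/A,\Pi,\Gamma_2\to C$; ($\to/$) from $\Pi,A\to B$ infer $\Pi\to B/A$; ($\mathbf{1}\to$) from $\Gamma_1,\Gamma_2\to C$ infer $\Gamma_1,\mathbf{1},\Gamma_2\to C$; ($\vee\to$) from $\Gamma_1,A_1,\Gamma_2\to C$ and $\Gamma_1,A_2,\Gamma_2\to C$ infer $\Gamma_1,A_1\vee A_2,\Gamma_2\to C$; ($\to\vee$) from $\Gamma\to A_i$ infer $\Gamma\to A_1\vee A_2$ ($i=1,2$); ($\wedge\to$) from $\Gamma_1,A_i,\Gamma_2\to C$ infer $\Gamma_1,A_1\wedge A_2,\Gamma_2\to C$ ($i=1,2$); ($\to\wedge$) from $\Gamma\to A_1$ and $\Gamma\to A_2$ infer $\Gamma\to A_1\wedge A_2$; (${!}\to$) from $\Gamma_1,A,\Gamma_2\to C$ infer $\Gamma_1,{!}^sA,\Gamma_2\to C$; ($\to{!}$) from ${!}^{s_1}A_1,\dots,{!}^{s_n}A_n\to B$ infer ${!}^{s_1}A_1,\dots,{!}^{s_n}A_n\to{!}^sB$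 provided $s\preceq s_j$ for all $j$; (weak) for $s\in\mathcal{W}$: from $\Gamma_1,\Gamma_2\to C$ infer $\Gamma_1,{!}^sA,\Gamma_2\to C$; (ncontr) for $s\in\mathcal{C}$: from $\Gamma_1,{!}^sA,\Delta,{!}^sA,\Gamma_2\to C$ infer $\Gamma_1,{!}^sA,\Delta,\Gamma_2\to C$, and also infer $\Gamma_1,\Delta,{!}^sA,\Gamma_2\to C$; (ex) for $s\in\mathcal{E}$: from $\Gamma_1,\Delta,{!}^sA,\Gamma_2\to C$ infer $\Gamma_1,{!}^sA,\Delta,\Gamma_2\to C$, and from $\Gamma_1,{!}^sA,\Delta,\Gamma_2\to C$ infer $\Gamma_1,\Delta,{!}^sA,\Gamma_2\to C$. Cut: from $\Pi\to A$ and $\Gamma_1,A,\Gamma_2\to C$ infer $\Gamma_1,\Pi,\Gamma_2\to C$; $\mathrm{SMALC}_\Sigma+(\mathrm{cut})$ is the system with cut. Cyclic linear logic with subexponentials, $\mathrm{SCLL}_\Sigma$. Atoms are $p_i$ and $\bar p_i$; formulae are built from atoms and constants $\mathbf{1},\bot,\top,\mathbf{0}$ with $\otimes$, $\wp$ (par), $\mathbin{\&}$, $\oplus$, ${!}^s$, ${?}^s$ ($s\in\mathcal{I}$). Negation: $p_i^\bot=\bar p_i$, $\bar p_i^\bot=p_i$, $(A\otimes B)^\bot=B^\bot\wp A^\bot$, $(A\wp B)^\bot=B^\bot\otimes A^\bot$, $(A\oplus B)^\bot=A^\bot\mathbin{\&}B^\bot$, $(A\mathbin{\&}B)^\bot=A^\bot\oplus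 B^\bot$, $({!}^sA)^\bot={?}^sA^\bot$, $({?}^sA)^\bot={!}^sA^\bot$, $\mathbf{1}^\bot=\bot$, $\bot^\bot=\mathbf{1}$, $\mathbf{0}^\bot=\top$, $\top^\bot=\mathbf{0}$. Sequents $\vdash\Gamma$ with $\Gamma$ a nonempty cyclically ordered sequence ($\vdash\Gamma_1,\Gamma_2$ identified with $\vdash\Gamma_2,\Gamma_1$, no other permutations). Rules of cut-free $\mathrm{SCLL}_\Sigma$: (ax) $\vdash A,A^\bot$; ($\otimes$) from $\vdash\Gamma,A$ and $\vdash B,\Delta$ infer $\vdash\Gamma,A\otimes B,\Delta$; ($\wp$) from $\vdash A,B,\Gamma$ infer $\vdash A\wp B,\Gamma$; ($\mathbin{\&}$) from $\vdash A_1,\Gamma$ and $\vdash A_2,\Gamma$ infer $\vdash A_1\mathbin{\&}A_2,\Gamma$; ($\oplus$) from $\vdash A_i,\Gamma$ infer $\vdash A_1\oplus A_2,\Gamma$; ($\mathbf{1}$) $\vdash\mathbf{1}$; ($\bot$) from $\vdash\Gamma$ infer $\vdash\bot,\Gamma$; ($\top$) $\vdash\top,\Gamma$; (${!}$) from $\vdash B,{?}^{s_1}A_1,\dots,{?}^{s_n}A_n$ infer $\vdash{!}^sB,{?}^{s_1}A_1,\dots,{?}^{s_n}A_n$ provided $s\preceq s_j$ for all $j$; (${?}$) from $\vdash A,\Gamma$ infer $\vdash{?}^sA,\Gamma$; (weak) $s\in\mathcal{W}$: from $\vdash\Gamma$ infer $\vdash{?}^sA,\Gamma$; (ncontr) $s\in\mathcal{C}$: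 from $\vdash{?}^sA,\Gamma,{?}^sA,\Delta$ infer $\vdash{?}^sA,\Gamma,\Delta$; (ex) $s\in\mathcal{E}$: from $\vdash\Gamma,{?}^sA,\Delta$ infer $\vdash{?}^sA,\Gamma,\Delta$. No rule for $\mathbf{0}$. Cut: from $\vdash\Gamma,A^\bot$ and $\vdash A,\Delta$ infer $\vdash\Gamma,\Delta$. Translation: $\widehat{p_i}=p_i$, $\widehat{\mathbf{1}}=\mathbf{1}$, $\widehat{A\cdot B}=\widehat A\otimes\widehat B$, $\widehat{A\backslash B}=\widehat A^\bot\wp\widehat B$, $\widehat{B/A}=\widehat B\wp\widehat A^\bot$, $\widehat{A\wedge B}=\widehat A\mathbin{\&}\widehat B$, $\widehat{A\vee B}=\widehat A\oplus\widehat B$, $\widehat{{!}^sA}={!}^s\widehat A$. For $\Pi=A_1,\dots,A_k$, $\widehat\Pi^\bot$ denotes the sequence $\widehat{A_k}^\bot,\dots,\widehat{A_1}^\bot$. -}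

module Defs where

open import Level using (0ℓ)
open import Data.Nat using (ℕ)
open import Data.Fin using (Fin)
open import Data.Bool using (Bool; true; false)
open import Data.List using (List; []; _∷_; _++_; [_]; map; reverse)
open import Data.List.Relation.Unary.All using (All)
open import Data.Product using (_×_; _,_; proj₁)
open import Relation.Binary.Core using (Rel)
open import Relation.Binary.Structures using (IsPreorder)
open import Relation.Binary.PropositionalEquality using (_≡_)
open import Relation.Unary using (Pred)
open import Relation.Nullary using (¬_)

record SubexpSig : Set₁ where
  field
    n          : ℕ
    _≼_        : Rel (Fin n) 0ℓ
    isPreorder : IsPreorder _≡_ _≼_
    W C E      : Pred (Fin n) 0ℓ
    W-up       : ∀ {s t} → s ≼ t → W s → W t
    C-up       : ∀ {s t} → s ≼ t → C s → C t
    E-up       : ∀ {s t} → s ≼ t → E s → E t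
    WC⊆E       : ∀ {s} → W s → C s → E s

  Label : Set
  Label = Fin n

infixr 30 _·_
data LFm (L : Set) : Set where
  var  : ℕ → LFm L
  𝟏    : LFm L
  _·_  : LFm L → LFm L → LFm L
  _∖_  : LFm L → LFm L → LFm L
  _⁄_  : LFm L → LFm L → LFm L
  _∧_  : LFm L → LFm L → LFm L
  _∨_  : LFm L → LFm L → LFm L
  !_[_] : L → LFm L → LFm L

-- Derivations of SMALC_Σ; the Bool index says whether (cut) is allowed.
-- SMALC_Σ = Bool index false, SMALC_Σ + (cut) = Bool index true.

module _ (Σ : SubexpSig) where
  open SubexpSig Σ

  bangs : List (Label × LFm Label) → List (LFm Label)
  bangs = map (λ { (s , A) → ! s [ A ] })

  data SMALC : Bool → List (LFm Label) → LFm Label → Set where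
    ax    : ∀ {c A} → SMALC c [ A ] A
    →𝟏    : ∀ {c} → SMALC c [] 𝟏
    ·→    : ∀ {c Γ₁ Γ₂ A B C'} → SMALC c (Γ₁ ++ A ∷ B ∷ Γ₂) C' → SMALC c (Γ₁ ++ (A · B) ∷ Γ₂) C'
    →·    : ∀ {c Γ₁ Γ₂ A B} → SMALC c Γ₁ A → SMALC c Γ₂ B → SMALC c (Γ₁ ++ Γ₂) (A · B)
    ∖→    : ∀ {c Π Γ₁ Γ₂ A B C'} → SMALC c Π A → SMALC c (Γ₁ ++ B ∷ Γ₂) C'
          → SMALC c (Γ₁ ++ Π ++ (A ∖ B) ∷ Γ₂) C'
    →∖    : ∀ {c Π A B} → SMALC c (A ∷ Π) B → SMALC c Π (A ∖ B)
    ⁄→    : ∀ {c Π Γ₁ Γ₂ A B C'} → SMALC c Π A → SMALC c (Γ₁ ++ B ∷ Γ₂) C'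
          → SMALC c (Γ₁ ++ (B ⁄ A) ∷ Π ++ Γ₂) C'
    →⁄    : ∀ {c Π A B} → SMALC c (Π ++ [ A ]) B → SMALC c Π (B ⁄ A)
    𝟏→    : ∀ {c Γ₁ Γ₂ C'} → SMALC c (Γ₁ ++ Γ₂) C' → SMALC c (Γ₁ ++ 𝟏 ∷ Γ₂) C'
    ∨→    : ∀ {c Γ₁ Γ₂ A₁ A₂ C'} → SMALC c (Γ₁ ++ A₁ ∷ Γ₂) C' → SMALC c (Γ₁ ++ A₂ ∷ Γ₂) C'
          → SMALC c (Γ₁ ++ (A₁ ∨ A₂) ∷ Γ₂) C'
    →∨₁   : ∀ {c Γ A₁ A₂} → SMALC c Γ A₁ → SMALC c Γ (A₁ ∨ A₂)
    →∨₂   : ∀ {c Γ A₁ A₂} → SMALC c Γ A₂ → SMALC c Γ (A₁ ∨ A₂)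
    ∧₁→   : ∀ {c Γ₁ Γ₂ A₁ A₂ C'} → SMALC c (Γ₁ ++ A₁ ∷ Γ₂) C' → SMALC c (Γ₁ ++ (A₁ ∧ A₂) ∷ Γ₂) C'
    ∧₂→   : ∀ {c Γ₁ Γ₂ A₁ A₂ C'} → SMALC c (Γ₁ ++ A₂ ∷ Γ₂) C' → SMALC c (Γ₁ ++ (A₁ ∧ A₂) ∷ Γ₂) C'
    →∧    : ∀ {c Γ A₁ A₂} → SMALC c Γ A₁ → SMALC c Γ A₂ → SMALC c Γ (A₁ ∧ A₂)
    !→    : ∀ {c Γ₁ Γ₂ s A C'} → SMALC c (Γ₁ ++ A ∷ Γ₂) C' → SMALC c (Γ₁ ++ ! s [ A ] ∷ Γ₂) C'
    →!    : ∀ {c qs s B} → All (λ q → s ≼ proj₁ q) qs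
          → SMALC c (bangs qs) B → SMALC c (bangs qs) (! s [ B ])
    weak  : ∀ {c Γ₁ Γ₂ s A C'} → W s → SMALC c (Γ₁ ++ Γ₂) C' → SMALC c (Γ₁ ++ ! s [ A ] ∷ Γ₂) C'
    ncontr₁ : ∀ {c Γ₁ Δ Γ₂ s A C'} → C s
          → SMALC c (Γ₁ ++ ! s [ A ] ∷ Δ ++ ! s [ A ] ∷ Γ₂) C'
          → SMALC c (Γ₁ ++ ! s [ A ] ∷ Δ ++ Γ₂) C'
    ncontr₂ : ∀ {c Γ₁ Δ Γ₂ s A C'} → C s
          → SMALC c (Γ₁ ++ ! s [ A ] ∷ Δ ++ ! s [ A ] ∷ Γ₂) C'
          → SMALC c (Γ₁ ++ Δ ++ ! s [ A ] ∷ Γ₂) C'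
    ex₁   : ∀ {c Γ₁ Δ Γ₂ s A C'} → E s
          → SMALC c (Γ₁ ++ Δ ++ ! s [ A ] ∷ Γ₂) C' → SMALC c (Γ₁ ++ ! s [ A ] ∷ Δ ++ Γ₂) C'
    ex₂   : ∀ {c Γ₁ Δ Γ₂ s A C'} → E s
          → SMALC c (Γ₁ ++ ! s [ A ] ∷ Δ ++ Γ₂) C' → SMALC c (Γ₁ ++ Δ ++ ! s [ A ] ∷ Γ₂) C'
    cut   : ∀ {Π Γ₁ Γ₂ A C'} → SMALC true Π A → SMALC true (Γ₁ ++ A ∷ Γ₂) C'
          → SMALC true (Γ₁ ++ Π ++ Γ₂) C'

data CFm (L : Set) : Set where
  pos  : ℕ → CFm L
  neg  : ℕ → CFm L
  𝟏 ⊥ ⊤ 𝟎 : CFm L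
  _⊗_ _⅋_ _&_ _⊕_ : CFm L → CFm L → CFm L
  ‼_[_] : L → CFm L → CFm L
  ⁇_[_] : L → CFm L → CFm L

_ᗮ : ∀ {L} → CFm L → CFm L
pos i ᗮ = neg i
neg i ᗮ = pos i
𝟏 ᗮ = ⊥
⊥ ᗮ = 𝟏
⊤ ᗮ = 𝟎
𝟎 ᗮ = ⊤
(A ⊗ B) ᗮ = (B ᗮ) ⅋ (A ᗮ)
(A ⅋ B) ᗮ = (B ᗮ) ⊗ (A ᗮ)
(A & B) ᗮ = (A ᗮ) ⊕ (B ᗮ)
(A ⊕ B) ᗮ = (A ᗮ) & (B ᗮ)
(‼ s [ A ]) ᗮ = ⁇ s [ A ᗮ ]
(⁇ s [ A ]) ᗮ = ‼ s [ A ᗮ ]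

-- Derivations of SCLL_Σ. Cyclic sequents are represented as lists,
-- with an explicit rotation rule (rot) realising the identification
-- ⊢ Γ₁,Γ₂ = ⊢ Γ₂,Γ₁. Bool index: whether (cut) is allowed.

module _ (Σ : SubexpSig) where
  open SubexpSig Σ

  whynots : List (Label × CFm Label) → List (CFm Label)
  whynots = map (λ { (s , A) → ⁇ s [ A ] })

  data SCLL : Bool → List (CFm Label) → Set where
    rot   : ∀ {c Γ₁ Γ₂} → SCLL c (Γ₁ ++ Γ₂) → SCLL c (Γ₂ ++ Γ₁)
    ax    : ∀ {c A} → SCLL c (A ∷ A ᗮ ∷ [])
    ⊗r    : ∀ {c Γ Δ A B} → SCLL c (Γ ++ [ A ]) → SCLL c (B ∷ Δ) → SCLL c (Γ ++ (A ⊗ B) ∷ Δ)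
    ⅋r    : ∀ {c Γ A B} → SCLL c (A ∷ B ∷ Γ) → SCLL c ((A ⅋ B) ∷ Γ)
    &r    : ∀ {c Γ A₁ A₂} → SCLL c (A₁ ∷ Γ) → SCLL c (A₂ ∷ Γ) → SCLL c ((A₁ & A₂) ∷ Γ)
    ⊕r₁   : ∀ {c Γ A₁ A₂} → SCLL c (A₁ ∷ Γ) → SCLL c ((A₁ ⊕ A₂) ∷ Γ)
    ⊕r₂   : ∀ {c Γ A₁ A₂} → SCLL c (A₂ ∷ Γ) → SCLL c ((A₁ ⊕ A₂) ∷ Γ)
    𝟏r    : ∀ {c} → SCLL c [ 𝟏 ]
    ⊥r    : ∀ {c Γ} → SCLL c Γ → SCLL c (⊥ ∷ Γ)
    ⊤r    : ∀ {c Γ} → SCLL c (⊤ ∷ Γ)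
    !r    : ∀ {c qs s B} → All (λ q → s ≼ proj₁ q) qs
          → SCLL c (B ∷ whynots qs) → SCLL c (‼ s [ B ] ∷ whynots qs)
    ?r    : ∀ {c Γ s A} → SCLL c (A ∷ Γ) → SCLL c (⁇ s [ A ] ∷ Γ)
    weak  : ∀ {c Γ s A} → W s → SCLL c Γ → SCLL c (⁇ s [ A ] ∷ Γ)
    ncontr : ∀ {c Γ Δ s A} → C s → SCLL c (⁇ s [ A ] ∷ Γ ++ ⁇ s [ A ] ∷ Δ)
          → SCLL c (⁇ s [ A ] ∷ Γ ++ Δ)
    ex    : ∀ {c Γ Δ s A} → E s → SCLL c (Γ ++ ⁇ s [ A ] ∷ Δ) → SCLL c (⁇ s [ A ] ∷ Γ ++ Δ)
    cut   : ∀ {Γ Δ A} → ¬ (Γ ++ Δ ≡ []) → SCLL true (Γ ++ [ A ᗮ ]) → SCLL true (A ∷ Δ) → SCLL true (Γ ++ Δ)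

⟦_⟧ : ∀ {L} → LFm L → CFm L
⟦ var i ⟧ = pos i
⟦ 𝟏 ⟧ = 𝟏
⟦ A · B ⟧ = ⟦ A ⟧ ⊗ ⟦ B ⟧
⟦ A ∖ B ⟧ = (⟦ A ⟧ ᗮ) ⅋ ⟦ B ⟧
⟦ B ⁄ A ⟧ = ⟦ B ⟧ ⅋ (⟦ A ⟧ ᗮ)
⟦ A ∧ B ⟧ = ⟦ A ⟧ & ⟦ B ⟧
⟦ A ∨ B ⟧ = ⟦ A ⟧ ⊕ ⟦ B ⟧
⟦ ! s [ A ] ⟧ = ‼ s [ ⟦ A ⟧ ]

⟦_⟧ᗮ : ∀ {L} → List (LFm L) → List (CFm L)
⟦ Π ⟧ᗮ = reverse (map (λ A → ⟦ A ⟧ ᗮ) Π)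

module Submission where

-- (1) ⇒ (2) and (4) ⇒ (3) are inclusions. For (2) ⇒ (3), every rule of SMALC, cut
-- included, becomes a few SCLL rules on the translated sequents read cyclically.
-- (3) ⇒ (4) is Okada's phase-semantic cut elimination: with Δ ∈ X ^⊥ iff Γ ++ Δ is
-- cut-free derivable for all Γ ∈ X, each formula A is interpreted by a fact ⟪ A ⟫,
-- every rule (cut included) preserves validity, and validity of a sequent yields its
-- cut-free derivability because [ A ] ∈ ⟪ A ⟫ ^⊥. For (4) ⇒ (1), every sequent in a
-- cut-free derivation of a translated sequent again consists of one formula ⟦ B ⟧
-- and formulas ⟦ A ⟧ ᗮ; this forces the polarities in each rule instance, which
-- then reads back as an SMALC rule.

open import Defs
open import Data.Bool using (Bool; true; false)
open import Data.Empty using (⊥-elim)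
open import Data.List using (List; []; _∷_; _++_; [_]; map; reverse)
open import Data.List.Properties using (++-assoc; ++-identityʳ; ++-conicalʳ; ++-monoid; map-++; reverse-++; ∷-injective)
open import Data.List.Relation.Unary.All using (All; []; _∷_)
import Data.List.Relation.Unary.All as All
import Data.List.Relation.Unary.All.Properties as All
open import Data.Product using (_×_; _,_; proj₁; proj₂; ∃; ∃₂)
open import Data.Sum using (_⊎_; inj₁; inj₂)
open import Data.Unit using (tt)
open import Function.Base using (_∘_)
open import Function.Bundles using (_⇔_; mk⇔)
open import Relation.Binary.PropositionalEquality using (_≡_; refl; sym; trans; cong; cong₂; subst; module ≡-Reasoning)
open import Relation.Nullary using (¬_)
open import Relation.Unary using (_⊆_; U)
open import Relation.Binary.Structures using (IsPreorder)
open import Tactic.MonoidSolver using (solve)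

module _ {A : Set} where

  ++-≡-++ : ∀ (ws xs ys zs : List A) → ws ++ xs ≡ ys ++ zs →
    (∃ λ M → ys ≡ ws ++ M × xs ≡ M ++ zs) ⊎ (∃ λ M → ws ≡ ys ++ M × zs ≡ M ++ xs)
  ++-≡-++ []       xs ys       zs eq = inj₁ (ys , refl , eq)
  ++-≡-++ (w ∷ ws) xs []       zs eq = inj₂ (w ∷ ws , refl , sym eq)
  ++-≡-++ (w ∷ ws) xs (y ∷ ys) zs eq with refl , eq′ ← ∷-injective eq
    with ++-≡-++ ws xs ys zs eq′
  ... | inj₁ (M , refl , eqₓ) = inj₁ (M , refl , eqₓ)
  ... | inj₂ (M , refl , eqₓ) = inj₂ (M , refl , eqₓ)

  ++-assoc₄ : ∀ (ws xs ys zs : List A) → ((ws ++ xs) ++ ys) ++ zs ≡ ws ++ xs ++ ys ++ zs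
  ++-assoc₄ ws xs ys zs = solve (++-monoid A)

ᗮ-involutive : ∀ {L} (A : CFm L) → A ᗮ ᗮ ≡ A
ᗮ-involutive (pos i)     = refl
ᗮ-involutive (neg i)     = refl
ᗮ-involutive 𝟏           = refl
ᗮ-involutive ⊥           = refl
ᗮ-involutive ⊤           = refl
ᗮ-involutive 𝟎           = refl
ᗮ-involutive (A ⊗ B)     = cong₂ _⊗_ (ᗮ-involutive A) (ᗮ-involutive B)
ᗮ-involutive (A ⅋ B)     = cong₂ _⅋_ (ᗮ-involutive A) (ᗮ-involutive B)
ᗮ-involutive (A & B)     = cong₂ _&_ (ᗮ-involutive A) (ᗮ-involutive B)
ᗮ-involutive (A ⊕ B)     = cong₂ _⊕_ (ᗮ-involutive A) (ᗮ-involutive B)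
ᗮ-involutive (‼ s [ A ]) = cong ‼ s [_] (ᗮ-involutive A)
ᗮ-involutive (⁇ s [ A ]) = cong ⁇ s [_] (ᗮ-involutive A)

⟦⟧ᗮ-++ : ∀ {L} (Γ Δ : List (LFm L)) → ⟦ Γ ++ Δ ⟧ᗮ ≡ ⟦ Δ ⟧ᗮ ++ ⟦ Γ ⟧ᗮ
⟦⟧ᗮ-++ Γ Δ = begin
  reverse (map _ (Γ ++ Δ))         ≡⟨ cong reverse (map-++ _ Γ Δ) ⟩
  reverse (map _ Γ ++ map _ Δ)     ≡⟨ reverse-++ (map _ Γ) (map _ Δ) ⟩
  ⟦ Δ ⟧ᗮ ++ ⟦ Γ ⟧ᗮ                 ∎
  where open ≡-Reasoning

SMALC-withCut : ∀ {Σ c Π B} → SMALC Σ c Π B → SMALC Σ true Π B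
SMALC-withCut ax             = ax
SMALC-withCut →𝟏             = →𝟏
SMALC-withCut (·→ d)         = ·→ (SMALC-withCut d)
SMALC-withCut (→· d e)       = →· (SMALC-withCut d) (SMALC-withCut e)
SMALC-withCut (∖→ d e)       = ∖→ (SMALC-withCut d) (SMALC-withCut e)
SMALC-withCut (→∖ d)         = →∖ (SMALC-withCut d)
SMALC-withCut (⁄→ d e)       = ⁄→ (SMALC-withCut d) (SMALC-withCut e)
SMALC-withCut (→⁄ d)         = →⁄ (SMALC-withCut d)
SMALC-withCut (𝟏→ d)         = 𝟏→ (SMALC-withCut d)
SMALC-withCut (∨→ d e)       = ∨→ (SMALC-withCut d) (SMALC-withCut e)
SMALC-withCut (→∨₁ d)        = →∨₁ (SMALC-withCut d)
SMALC-withCut (→∨₂ d)        = →∨₂ (SMALC-withCut d)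
SMALC-withCut (∧₁→ d)        = ∧₁→ (SMALC-withCut d)
SMALC-withCut (∧₂→ d)        = ∧₂→ (SMALC-withCut d)
SMALC-withCut (→∧ d e)       = →∧ (SMALC-withCut d) (SMALC-withCut e)
SMALC-withCut (!→ d)         = !→ (SMALC-withCut d)
SMALC-withCut (→! ≼s d)      = →! ≼s (SMALC-withCut d)
SMALC-withCut (weak w d)     = weak w (SMALC-withCut d)
SMALC-withCut (ncontr₁ c d)  = ncontr₁ c (SMALC-withCut d)
SMALC-withCut (ncontr₂ c d)  = ncontr₂ c (SMALC-withCut d)
SMALC-withCut (ex₁ e d)      = ex₁ e (SMALC-withCut d)
SMALC-withCut (ex₂ e d)      = ex₂ e (SMALC-withCut d)
SMALC-withCut (cut d e)      = cut d e

SCLL-withCut : ∀ {Σ c Γ} → SCLL Σ c Γ → SCLL Σ true Γ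
SCLL-withCut (rot {Γ₁ = Γ₁} {Γ₂} d) = rot {Γ₁ = Γ₁} {Γ₂} (SCLL-withCut d)
SCLL-withCut ax            = ax
SCLL-withCut (⊗r d e)      = ⊗r (SCLL-withCut d) (SCLL-withCut e)
SCLL-withCut (⅋r d)        = ⅋r (SCLL-withCut d)
SCLL-withCut (&r d e)      = &r (SCLL-withCut d) (SCLL-withCut e)
SCLL-withCut (⊕r₁ d)       = ⊕r₁ (SCLL-withCut d)
SCLL-withCut (⊕r₂ d)       = ⊕r₂ (SCLL-withCut d)
SCLL-withCut 𝟏r            = 𝟏r
SCLL-withCut (⊥r d)        = ⊥r (SCLL-withCut d)
SCLL-withCut ⊤r            = ⊤r
SCLL-withCut (!r ≼s d)     = !r ≼s (SCLL-withCut d)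
SCLL-withCut (?r d)        = ?r (SCLL-withCut d)
SCLL-withCut (weak w d)    = weak w (SCLL-withCut d)
SCLL-withCut (ncontr c d)  = ncontr c (SCLL-withCut d)
SCLL-withCut (ex e d)      = ex e (SCLL-withCut d)
SCLL-withCut (cut ne d e)  = cut ne d e

module Cyclic (Σ : SubexpSig) {c : Bool} where
  open SubexpSig Σ

  infix 4 ⊢_
  ⊢_ : List (CFm Label) → Set
  ⊢ Γ = SCLL Σ c Γ

  cast : ∀ {Γ Δ} → Γ ≡ Δ → ⊢ Γ → ⊢ Δ
  cast = subst ⊢_

  rotate : ∀ Γ Δ → ⊢ Γ ++ Δ → ⊢ Δ ++ Γ
  rotate Γ Δ = rot {Γ₁ = Γ} {Γ₂ = Δ}

  rotate-≡ : ∀ Γ Δ {Θ Θ′} → Θ ≡ Γ ++ Δ → Δ ++ Γ ≡ Θ′ → ⊢ Θ → ⊢ Θ′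
  rotate-≡ Γ Δ refl refl = rotate Γ Δ

  ⊗r-front : ∀ {Γ Δ A B} → ⊢ Γ ++ [ A ] → ⊢ B ∷ Δ → ⊢ (A ⊗ B) ∷ Δ ++ Γ
  ⊗r-front {Γ} {Δ} {A} {B} d e = rotate Γ ((A ⊗ B) ∷ Δ) (⊗r d e)

  last-to-front : ∀ {Γ A} → ⊢ Γ ++ [ A ] → ⊢ A ∷ Γ
  last-to-front {Γ} {A} = rotate Γ [ A ]

  front-to-last : ∀ {Γ A} → ⊢ A ∷ Γ → ⊢ Γ ++ [ A ]
  front-to-last {Γ} {A} = rotate [ A ] Γ

  onLast : ∀ {Γ A B} → (⊢ A ∷ Γ → ⊢ B ∷ Γ) → ⊢ Γ ++ [ A ] → ⊢ Γ ++ [ B ]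
  onLast f d = front-to-last (f (last-to-front d))

  ex⁻¹ : ∀ {Γ Δ s A} → E s → ⊢ ⁇ s [ A ] ∷ Γ ++ Δ → ⊢ Γ ++ ⁇ s [ A ] ∷ Δ
  ex⁻¹ {Γ} {Δ} {s} {A} e d = rotate (⁇ s [ A ] ∷ Δ) Γ (ex e (rotate (⁇ s [ A ] ∷ Γ) Δ d))

  ncontr-keepSecond : ∀ {Γ Δ s A} → C s → ⊢ ⁇ s [ A ] ∷ Γ ++ ⁇ s [ A ] ∷ Δ → ⊢ Γ ++ ⁇ s [ A ] ∷ Δ
  ncontr-keepSecond {Γ} {Δ} {s} {A} c d =
    rotate (⁇ s [ A ] ∷ Δ) Γ (ncontr c (rotate (⁇ s [ A ] ∷ Γ) (⁇ s [ A ] ∷ Δ) d))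

  weaken-all : ∀ {qs Γ} → All (λ q → W (proj₁ q)) qs → ⊢ Γ → ⊢ whynots Σ qs ++ Γ
  weaken-all []       d = d
  weaken-all (w ∷ ws) d = weak w (weaken-all ws d)

  exchange-all : ∀ {qs} Γ Δ → All (λ q → E (proj₁ q)) qs →
    ⊢ Γ ++ whynots Σ qs ++ Δ → ⊢ whynots Σ qs ++ Γ ++ Δ
  exchange-all             Γ Δ []       d = d
  exchange-all {(t , A) ∷ qs} Γ Δ (e ∷ es) d =
    cast (cong (q ∷_) (++-assoc Ψ Γ Δ)) (ex e
      (cast (sym (++-assoc Ψ Γ (q ∷ Δ))) (cast (cong (Ψ ++_) (++-assoc Γ [ q ] Δ))
        (exchange-all (Γ ++ [ q ]) Δ es (cast (sym (++-assoc Γ [ q ] (Ψ ++ Δ))) d)))))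
    where
    q = ⁇ t [ A ]
    Ψ = whynots Σ qs

  contract-all : ∀ {qs} Γ Δ → All (λ q → C (proj₁ q)) qs →
    ⊢ whynots Σ qs ++ Γ ++ whynots Σ qs ++ Δ → ⊢ whynots Σ qs ++ Γ ++ Δ
  contract-all             Γ Δ []       d = d
  contract-all {(t , A) ∷ qs} Γ Δ (c ∷ cs) d =
    last-to-front (cast assocₗ (contract-all Γ (Δ ++ [ q ]) cs (cast assocᵣ
      (front-to-last (ncontr c (cast (cong (q ∷_) (sym (++-assoc Ψ Γ (q ∷ Ψ ++ Δ)))) d))))))
    where
    q = ⁇ t [ A ]
    Ψ = whynots Σ qs
    assocᵣ : ((Ψ ++ Γ) ++ Ψ ++ Δ) ++ [ q ] ≡ Ψ ++ Γ ++ Ψ ++ Δ ++ [ q ]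
    assocᵣ = solve (++-monoid (CFm Label))
    assocₗ : Ψ ++ Γ ++ Δ ++ [ q ] ≡ (Ψ ++ Γ ++ Δ) ++ [ q ]
    assocₗ = solve (++-monoid (CFm Label))

module Translation (Σ : SubexpSig) {c : Bool} where
  open SubexpSig Σ
  open Cyclic Σ {c}

  ⟦_⇒_⟧ : List (LFm Label) → LFm Label → List (CFm Label)
  ⟦ Π ⇒ B ⟧ = ⟦ Π ⟧ᗮ ++ [ ⟦ B ⟧ ]

  -- Γ₁ ++ Θ ++ Γ₂ ⇒ C, read cyclically starting from Θ, is ⟦ Θ ⟧ᗮ ++ frame Γ₁ C Γ₂.
  frame : List (LFm Label) → LFm Label → List (LFm Label) → List (CFm Label)
  frame Γ₁ C Γ₂ = ⟦ Γ₁ ⟧ᗮ ++ [ ⟦ C ⟧ ] ++ ⟦ Γ₂ ⟧ᗮ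

  ⟦⇒⟧-split : ∀ Γ₁ Θ Γ₂ (C : LFm Label) → ⟦ Γ₁ ++ Θ ++ Γ₂ ⇒ C ⟧ ≡ ⟦ Γ₂ ⟧ᗮ ++ ⟦ Θ ⟧ᗮ ++ ⟦ Γ₁ ⟧ᗮ ++ [ ⟦ C ⟧ ]
  ⟦⇒⟧-split Γ₁ Θ Γ₂ C = begin
    ⟦ Γ₁ ++ Θ ++ Γ₂ ⟧ᗮ ++ [ ⟦ C ⟧ ]                 ≡⟨ cong (_++ [ ⟦ C ⟧ ]) (⟦⟧ᗮ-++ Γ₁ (Θ ++ Γ₂)) ⟩
    (⟦ Θ ++ Γ₂ ⟧ᗮ ++ ⟦ Γ₁ ⟧ᗮ) ++ [ ⟦ C ⟧ ]         ≡⟨ cong (λ Δ → (Δ ++ ⟦ Γ₁ ⟧ᗮ) ++ [ ⟦ C ⟧ ]) (⟦⟧ᗮ-++ Θ Γ₂) ⟩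
    ((⟦ Γ₂ ⟧ᗮ ++ ⟦ Θ ⟧ᗮ) ++ ⟦ Γ₁ ⟧ᗮ) ++ [ ⟦ C ⟧ ]  ≡⟨ solve (++-monoid (CFm Label)) ⟩
    ⟦ Γ₂ ⟧ᗮ ++ ⟦ Θ ⟧ᗮ ++ ⟦ Γ₁ ⟧ᗮ ++ [ ⟦ C ⟧ ]      ∎
    where open ≡-Reasoning

  focus : ∀ Γ₁ Θ Γ₂ {C : LFm Label} → ⊢ ⟦ Γ₁ ++ Θ ++ Γ₂ ⇒ C ⟧ → ⊢ ⟦ Θ ⟧ᗮ ++ frame Γ₁ C Γ₂
  focus Γ₁ Θ Γ₂ {C} = rotate-≡ ⟦ Γ₂ ⟧ᗮ (⟦ Θ ⟧ᗮ ++ ⟦ Γ₁ ⟧ᗮ ++ [ ⟦ C ⟧ ])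
    (⟦⇒⟧-split Γ₁ Θ Γ₂ C) (solve (++-monoid (CFm Label)))

  unfocus : ∀ Γ₁ Θ Γ₂ {C : LFm Label} → ⊢ ⟦ Θ ⟧ᗮ ++ frame Γ₁ C Γ₂ → ⊢ ⟦ Γ₁ ++ Θ ++ Γ₂ ⇒ C ⟧
  unfocus Γ₁ Θ Γ₂ {C} = rotate-≡ (⟦ Θ ⟧ᗮ ++ ⟦ Γ₁ ⟧ᗮ ++ [ ⟦ C ⟧ ]) ⟦ Γ₂ ⟧ᗮ
    (solve (++-monoid (CFm Label))) (sym (⟦⇒⟧-split Γ₁ Θ Γ₂ C))

  inContext : ∀ Γ₁ Θ Θ′ Γ₂ {C : LFm Label} →
    (⊢ ⟦ Θ ⟧ᗮ ++ frame Γ₁ C Γ₂ → ⊢ ⟦ Θ′ ⟧ᗮ ++ frame Γ₁ C Γ₂) →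
    ⊢ ⟦ Γ₁ ++ Θ ++ Γ₂ ⇒ C ⟧ → ⊢ ⟦ Γ₁ ++ Θ′ ++ Γ₂ ⇒ C ⟧
  inContext Γ₁ Θ Θ′ Γ₂ f d = unfocus Γ₁ Θ′ Γ₂ (f (focus Γ₁ Θ Γ₂ d))

  cast-antecedent : ∀ {Γ Γ′ C} → Γ ≡ Γ′ → ⊢ ⟦ Γ ⇒ C ⟧ → ⊢ ⟦ Γ′ ⇒ C ⟧
  cast-antecedent {C = C} eq = cast (cong (λ Γ → ⟦ Γ ⇒ C ⟧) eq)

  ++-∷ʳ-++ : ∀ (Γ₁ Δ : List (LFm Label)) X Γ₂ → Γ₁ ++ (Δ ++ [ X ]) ++ Γ₂ ≡ Γ₁ ++ Δ ++ X ∷ Γ₂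
  ++-∷ʳ-++ Γ₁ Δ X Γ₂ = cong (Γ₁ ++_) (++-assoc Δ [ X ] Γ₂)

  ⟦∷⟧ᗮ-++ : ∀ (X : LFm Label) Δ R → ⟦ X ∷ Δ ⟧ᗮ ++ R ≡ ⟦ Δ ⟧ᗮ ++ (⟦ X ⟧ ᗮ) ∷ R
  ⟦∷⟧ᗮ-++ X Δ R = trans (cong (_++ R) (⟦⟧ᗮ-++ [ X ] Δ)) (++-assoc ⟦ Δ ⟧ᗮ _ R)

  ⟦∷ʳ⟧ᗮ-++ : ∀ Δ (X : LFm Label) R → ⟦ Δ ++ [ X ] ⟧ᗮ ++ R ≡ (⟦ X ⟧ ᗮ) ∷ ⟦ Δ ⟧ᗮ ++ R
  ⟦∷ʳ⟧ᗮ-++ Δ X R = cong (_++ R) (⟦⟧ᗮ-++ Δ [ X ])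

  frame-nonempty : ∀ Γ₁ (C : LFm Label) Γ₂ Δ → ¬ (Δ ++ frame Γ₁ C Γ₂ ≡ [])
  frame-nonempty Γ₁ C′ Γ₂ Δ eq with () ← ++-conicalʳ ⟦ Γ₁ ⟧ᗮ _ (++-conicalʳ Δ _ eq)

  ⟦_⟧ᵇ : List (Label × LFm Label) → List (Label × CFm Label)
  ⟦ [] ⟧ᵇ          = []
  ⟦ (t , A) ∷ qs ⟧ᵇ = ⟦ qs ⟧ᵇ ++ [ t , ⟦ A ⟧ ᗮ ]

  ⟦bangs⟧ᗮ : ∀ qs → ⟦ bangs Σ qs ⟧ᗮ ≡ whynots Σ ⟦ qs ⟧ᵇ
  ⟦bangs⟧ᗮ []             = refl
  ⟦bangs⟧ᗮ ((t , A) ∷ qs) = begin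
    ⟦ ! t [ A ] ∷ bangs Σ qs ⟧ᗮ                     ≡⟨ ⟦⟧ᗮ-++ [ ! t [ A ] ] (bangs Σ qs) ⟩
    ⟦ bangs Σ qs ⟧ᗮ ++ [ ⁇ t [ ⟦ A ⟧ ᗮ ] ]          ≡⟨ cong (_++ _) (⟦bangs⟧ᗮ qs) ⟩
    whynots Σ ⟦ qs ⟧ᵇ ++ whynots Σ [ t , ⟦ A ⟧ ᗮ ]  ≡⟨ map-++ _ ⟦ qs ⟧ᵇ _ ⟨
    whynots Σ ⟦ (t , A) ∷ qs ⟧ᵇ                     ∎
    where open ≡-Reasoning

  ⟦⟧ᵇ-All : ∀ {s} qs → All (λ q → s ≼ proj₁ q) qs → All (λ q → s ≼ proj₁ q) ⟦ qs ⟧ᵇ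
  ⟦⟧ᵇ-All []       []         = []
  ⟦⟧ᵇ-All (_ ∷ qs) (s≼t ∷ ≼s) = All.++⁺ (⟦⟧ᵇ-All qs ≼s) (s≼t ∷ [])

  ncontr₁ᵀ : ∀ (Δ : List (LFm Label)) {s A R} → C s →
    ⊢ ⟦ ! s [ A ] ∷ Δ ++ [ ! s [ A ] ] ⟧ᗮ ++ R → ⊢ ⟦ ! s [ A ] ∷ Δ ⟧ᗮ ++ R
  ncontr₁ᵀ Δ {s} {A} {R} c d = cast (sym (⟦∷⟧ᗮ-++ (! s [ A ]) Δ R)) (ncontr-keepSecond c
    (cast (trans (⟦∷ʳ⟧ᗮ-++ (! s [ A ] ∷ Δ) (! s [ A ]) R) (cong (_ ∷_) (⟦∷⟧ᗮ-++ (! s [ A ]) Δ R))) d))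

  ncontr₂ᵀ : ∀ (Δ : List (LFm Label)) {s A R} → C s →
    ⊢ ⟦ ! s [ A ] ∷ Δ ++ [ ! s [ A ] ] ⟧ᗮ ++ R → ⊢ ⟦ Δ ++ [ ! s [ A ] ] ⟧ᗮ ++ R
  ncontr₂ᵀ Δ {s} {A} {R} c d = cast (sym (⟦∷ʳ⟧ᗮ-++ Δ (! s [ A ]) R)) (ncontr c
    (cast (trans (⟦∷ʳ⟧ᗮ-++ (! s [ A ] ∷ Δ) (! s [ A ]) R) (cong (_ ∷_) (⟦∷⟧ᗮ-++ (! s [ A ]) Δ R))) d))

  ex₁ᵀ : ∀ (Δ : List (LFm Label)) {s A R} → E s → ⊢ ⟦ Δ ++ [ ! s [ A ] ] ⟧ᗮ ++ R → ⊢ ⟦ ! s [ A ] ∷ Δ ⟧ᗮ ++ R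
  ex₁ᵀ Δ {s} {A} {R} e d =
    cast (sym (⟦∷⟧ᗮ-++ (! s [ A ]) Δ R)) (ex⁻¹ e (cast (⟦∷ʳ⟧ᗮ-++ Δ (! s [ A ]) R) d))

  ex₂ᵀ : ∀ (Δ : List (LFm Label)) {s A R} → E s → ⊢ ⟦ ! s [ A ] ∷ Δ ⟧ᗮ ++ R → ⊢ ⟦ Δ ++ [ ! s [ A ] ] ⟧ᗮ ++ R
  ex₂ᵀ Δ {s} {A} {R} e d =
    cast (sym (⟦∷ʳ⟧ᗮ-++ Δ (! s [ A ]) R)) (ex e (cast (⟦∷⟧ᗮ-++ (! s [ A ]) Δ R) d))

  ⟦_⟧ᴰ : ∀ {Π B} → SMALC Σ c Π B → ⊢ ⟦ Π ⇒ B ⟧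
  ⟦ ax {A = A} ⟧ᴰ = rotate [ ⟦ A ⟧ ] [ ⟦ A ⟧ ᗮ ] ax
  ⟦ →𝟏 ⟧ᴰ = 𝟏r
  ⟦ ·→ {Γ₁ = Γ₁} {Γ₂} {A} {B} d ⟧ᴰ = inContext Γ₁ (A ∷ B ∷ []) [ A · B ] Γ₂ ⅋r ⟦ d ⟧ᴰ
  ⟦ →· {Γ₁ = Γ₁} {Γ₂} d e ⟧ᴰ =
    cast (sym (cong (_++ _) (⟦⟧ᗮ-++ Γ₁ Γ₂))) (front-to-last (⊗r-front ⟦ d ⟧ᴰ (last-to-front ⟦ e ⟧ᴰ)))
  ⟦ ∖→ {Π = Π} {Γ₁} {Γ₂} {A} {B} d e ⟧ᴰ =
    cast-antecedent (++-∷ʳ-++ Γ₁ Π (A ∖ B) Γ₂) (unfocus Γ₁ (Π ++ [ A ∖ B ]) Γ₂ (cast (sym (⟦∷ʳ⟧ᗮ-++ Π (A ∖ B) _))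
      (⊗r-front (front-to-last (focus Γ₁ [ B ] Γ₂ ⟦ e ⟧ᴰ))
                (cast (cong (_∷ _) (sym (ᗮ-involutive ⟦ A ⟧))) (last-to-front ⟦ d ⟧ᴰ)))))
  ⟦ →∖ {Π = Π} {A} {B} d ⟧ᴰ =
    front-to-last (⅋r (rotate-≡ ⟦ Π ⟧ᗮ (⟦ A ⟧ ᗮ ∷ [ ⟦ B ⟧ ]) (⟦∷⟧ᗮ-++ A Π [ ⟦ B ⟧ ]) refl ⟦ d ⟧ᴰ))
  ⟦ ⁄→ {Π = Π} {Γ₁} {Γ₂} {A} {B} d e ⟧ᴰ =
    unfocus Γ₁ (B ⁄ A ∷ Π) Γ₂ (cast (sym (⟦∷⟧ᗮ-++ (B ⁄ A) Π _))
      (⊗r (cast (cong (λ X → ⟦ Π ⟧ᗮ ++ [ X ]) (sym (ᗮ-involutive ⟦ A ⟧))) ⟦ d ⟧ᴰ) (focus Γ₁ [ B ] Γ₂ ⟦ e ⟧ᴰ)))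
  ⟦ →⁄ {Π = Π} {A} {B} d ⟧ᴰ =
    front-to-last (⅋r (last-to-front (cast (cong (_++ [ ⟦ B ⟧ ]) (⟦⟧ᗮ-++ Π [ A ])) ⟦ d ⟧ᴰ)))
  ⟦ 𝟏→ {Γ₁ = Γ₁} {Γ₂} d ⟧ᴰ = inContext Γ₁ [] [ 𝟏 ] Γ₂ ⊥r ⟦ d ⟧ᴰ
  ⟦ ∨→ {Γ₁ = Γ₁} {Γ₂} {A₁} {A₂} d e ⟧ᴰ =
    unfocus Γ₁ [ A₁ ∨ A₂ ] Γ₂ (&r (focus Γ₁ [ A₁ ] Γ₂ ⟦ d ⟧ᴰ) (focus Γ₁ [ A₂ ] Γ₂ ⟦ e ⟧ᴰ))
  ⟦ →∨₁ d ⟧ᴰ = onLast ⊕r₁ ⟦ d ⟧ᴰ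
  ⟦ →∨₂ d ⟧ᴰ = onLast ⊕r₂ ⟦ d ⟧ᴰ
  ⟦ ∧₁→ {Γ₁ = Γ₁} {Γ₂} {A₁} {A₂} d ⟧ᴰ = inContext Γ₁ [ A₁ ] [ A₁ ∧ A₂ ] Γ₂ ⊕r₁ ⟦ d ⟧ᴰ
  ⟦ ∧₂→ {Γ₁ = Γ₁} {Γ₂} {A₁} {A₂} d ⟧ᴰ = inContext Γ₁ [ A₂ ] [ A₁ ∧ A₂ ] Γ₂ ⊕r₂ ⟦ d ⟧ᴰ
  ⟦ →∧ d e ⟧ᴰ = front-to-last (&r (last-to-front ⟦ d ⟧ᴰ) (last-to-front ⟦ e ⟧ᴰ))
  ⟦ !→ {Γ₁ = Γ₁} {Γ₂} {s} {A} d ⟧ᴰ = inContext Γ₁ [ A ] [ ! s [ A ] ] Γ₂ ?r ⟦ d ⟧ᴰ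
  ⟦ →! {qs = qs} {B = B} ≼s d ⟧ᴰ =
    cast (sym (cong (_++ _) (⟦bangs⟧ᗮ qs)))
      (onLast {Γ = whynots Σ ⟦ qs ⟧ᵇ} (!r (⟦⟧ᵇ-All qs ≼s)) (cast (cong (_++ [ ⟦ B ⟧ ]) (⟦bangs⟧ᗮ qs)) ⟦ d ⟧ᴰ))
  ⟦ weak {Γ₁ = Γ₁} {Γ₂} {s} {A} w d ⟧ᴰ = inContext Γ₁ [] [ ! s [ A ] ] Γ₂ (weak w) ⟦ d ⟧ᴰ
  ⟦ ncontr₁ {Γ₁ = Γ₁} {Δ} {Γ₂} {s} {A} c d ⟧ᴰ =
    inContext Γ₁ (! s [ A ] ∷ Δ ++ [ ! s [ A ] ]) (! s [ A ] ∷ Δ) Γ₂ (ncontr₁ᵀ Δ c)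
      (cast-antecedent (sym (++-∷ʳ-++ Γ₁ (_ ∷ Δ) _ Γ₂)) ⟦ d ⟧ᴰ)
  ⟦ ncontr₂ {Γ₁ = Γ₁} {Δ} {Γ₂} {s} {A} c d ⟧ᴰ =
    cast-antecedent (++-∷ʳ-++ Γ₁ Δ _ Γ₂)
      (inContext Γ₁ (! s [ A ] ∷ Δ ++ [ ! s [ A ] ]) (Δ ++ [ ! s [ A ] ]) Γ₂ (ncontr₂ᵀ Δ c)
        (cast-antecedent (sym (++-∷ʳ-++ Γ₁ (_ ∷ Δ) _ Γ₂)) ⟦ d ⟧ᴰ))
  ⟦ ex₁ {Γ₁ = Γ₁} {Δ} {Γ₂} {s} {A} e d ⟧ᴰ =
    inContext Γ₁ (Δ ++ [ ! s [ A ] ]) (! s [ A ] ∷ Δ) Γ₂ (ex₁ᵀ Δ e)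
      (cast-antecedent (sym (++-∷ʳ-++ Γ₁ Δ _ Γ₂)) ⟦ d ⟧ᴰ)
  ⟦ ex₂ {Γ₁ = Γ₁} {Δ} {Γ₂} {s} {A} e d ⟧ᴰ =
    cast-antecedent (++-∷ʳ-++ Γ₁ Δ _ Γ₂)
      (inContext Γ₁ (! s [ A ] ∷ Δ) (Δ ++ [ ! s [ A ] ]) Γ₂ (ex₂ᵀ Δ e) ⟦ d ⟧ᴰ)
  ⟦ cut {Π = Π} {Γ₁} {Γ₂} {A} {C′} d e ⟧ᴰ =
    unfocus Γ₁ Π Γ₂ (cut (frame-nonempty Γ₁ C′ Γ₂ ⟦ Π ⟧ᗮ)
      (cast (cong (λ X → ⟦ Π ⟧ᗮ ++ [ X ]) (sym (ᗮ-involutive ⟦ A ⟧))) ⟦ d ⟧ᴰ) (focus Γ₁ [ A ] Γ₂ ⟦ e ⟧ᴰ))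

module CutElimination (Σ : SubexpSig) where
  open SubexpSig Σ
  open Cyclic Σ {false}
  private module ≼ = IsPreorder isPreorder

  Phase : Set₁
  Phase = List (CFm Label) → Set

  infixl 30 _^⊥
  record _^⊥ (X : Phase) (Δ : List (CFm Label)) : Set where
    constructor orth
    field pair : ∀ Γ → X Γ → ⊢ Γ ++ Δ
  open _^⊥

  ⊆-^⊥^⊥ : ∀ {X} → X ⊆ X ^⊥ ^⊥
  ⊆-^⊥^⊥ {x = Γ} Γ∈X = orth λ Δ Δ∈ → rotate Γ Δ (pair Δ∈ Γ Γ∈X)

  ^⊥-antitone : ∀ {X Y} → X ⊆ Y → Y ^⊥ ⊆ X ^⊥
  ^⊥-antitone X⊆Y Δ∈ = orth λ Γ Γ∈X → pair Δ∈ Γ (X⊆Y Γ∈X)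

  ^⊥^⊥^⊥ : ∀ {X} → X ^⊥ ^⊥ ^⊥ ⊆ X ^⊥
  ^⊥^⊥^⊥ = ^⊥-antitone ⊆-^⊥^⊥

  ⟨_⟩ : List (CFm Label) → Phase
  ⟨ Δ ⟩ Γ = Γ ≡ Δ

  infixr 20 _·ˢ_ _∪ˢ_ _∩ˢ_
  data _·ˢ_ (X Y : Phase) : List (CFm Label) → Set where
    _++ˢ_ : ∀ {Γ Δ} → X Γ → Y Δ → (X ·ˢ Y) (Γ ++ Δ)

  data _∪ˢ_ (X Y : Phase) (Γ : List (CFm Label)) : Set where
    left  : X Γ → (X ∪ˢ Y) Γ
    right : Y Γ → (X ∪ˢ Y) Γ

  data _∩ˢ_ (X Y : Phase) (Γ : List (CFm Label)) : Set where
    _,_ : X Γ → Y Γ → (X ∩ˢ Y) Γ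

  Promotable : Label → Phase
  Promotable s Γ = ∃ λ qs → Γ ≡ whynots Σ qs × All (λ q → s ≼ proj₁ q) qs

  -- ⟪ A ⟫ consists of the contexts that behave like A ᗮ (see ᗮ∈⟪⟫), whence
  -- the reversed product for ⊗, mirroring (A ⊗ B) ᗮ = B ᗮ ⅋ A ᗮ.
  ⟪_⟫ : CFm Label → Phase
  ⟪ pos i ⟫     = ⟨ [ pos i ] ⟩ ^⊥
  ⟪ neg i ⟫     = ⟨ [ pos i ] ⟩ ^⊥ ^⊥
  ⟪ 𝟏 ⟫         = ⟨ [] ⟩ ^⊥ ^⊥
  ⟪ ⊥ ⟫         = ⟨ [] ⟩ ^⊥
  ⟪ ⊤ ⟫         = U
  ⟪ 𝟎 ⟫         = U ^⊥
  ⟪ A ⊗ B ⟫     = (⟪ B ⟫ ·ˢ ⟪ A ⟫) ^⊥ ^⊥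
  ⟪ A ⅋ B ⟫     = (⟪ A ⟫ ^⊥ ·ˢ ⟪ B ⟫ ^⊥) ^⊥
  ⟪ A & B ⟫     = (⟪ A ⟫ ^⊥ ∪ˢ ⟪ B ⟫ ^⊥) ^⊥
  ⟪ A ⊕ B ⟫     = (⟪ A ⟫ ∪ˢ ⟪ B ⟫) ^⊥ ^⊥
  ⟪ ‼ s [ A ] ⟫ = (⟪ A ⟫ ∩ˢ Promotable s) ^⊥ ^⊥
  ⟪ ⁇ s [ A ] ⟫ = (⟪ A ⟫ ^⊥ ∩ˢ Promotable s) ^⊥

  ⟪⟫-closed : ∀ A → ⟪ A ⟫ ^⊥ ^⊥ ⊆ ⟪ A ⟫
  ⟪⟫-closed (pos i)     = ^⊥^⊥^⊥
  ⟪⟫-closed (neg i)     = ^⊥^⊥^⊥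
  ⟪⟫-closed 𝟏           = ^⊥^⊥^⊥
  ⟪⟫-closed ⊥           = ^⊥^⊥^⊥
  ⟪⟫-closed ⊤           = λ _ → tt
  ⟪⟫-closed 𝟎           = ^⊥^⊥^⊥
  ⟪⟫-closed (A ⊗ B)     = ^⊥^⊥^⊥
  ⟪⟫-closed (A ⅋ B)     = ^⊥^⊥^⊥
  ⟪⟫-closed (A & B)     = ^⊥^⊥^⊥
  ⟪⟫-closed (A ⊕ B)     = ^⊥^⊥^⊥
  ⟪⟫-closed (‼ s [ A ]) = ^⊥^⊥^⊥
  ⟪⟫-closed (⁇ s [ A ]) = ^⊥^⊥^⊥

  ·ˢ-mono : ∀ {X X′ Y Y′} → X ⊆ X′ → Y ⊆ Y′ → X ·ˢ Y ⊆ X′ ·ˢ Y′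
  ·ˢ-mono f g (x ++ˢ y) = f x ++ˢ g y

  ∪ˢ-mono : ∀ {X X′ Y Y′} → X ⊆ X′ → Y ⊆ Y′ → X ∪ˢ Y ⊆ X′ ∪ˢ Y′
  ∪ˢ-mono f g (left x)  = left (f x)
  ∪ˢ-mono f g (right y) = right (g y)

  ∩ˢ-monoˡ : ∀ {X X′ Y} → X ⊆ X′ → X ∩ˢ Y ⊆ X′ ∩ˢ Y
  ∩ˢ-monoˡ f (x , y) = f x , y

  ⟪ᗮ⟫⊆⟪⟫^⊥ : ∀ A → ⟪ A ᗮ ⟫ ⊆ ⟪ A ⟫ ^⊥
  ⟪⟫^⊥⊆⟪ᗮ⟫ : ∀ A → ⟪ A ⟫ ^⊥ ⊆ ⟪ A ᗮ ⟫

  ⟪⟫⊆⟪ᗮ⟫^⊥ : ∀ A → ⟪ A ⟫ ⊆ ⟪ A ᗮ ⟫ ^⊥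
  ⟪⟫⊆⟪ᗮ⟫^⊥ A x = ^⊥-antitone (⟪ᗮ⟫⊆⟪⟫^⊥ A) (⊆-^⊥^⊥ x)

  ⟪ᗮ⟫^⊥⊆⟪⟫ : ∀ A → ⟪ A ᗮ ⟫ ^⊥ ⊆ ⟪ A ⟫
  ⟪ᗮ⟫^⊥⊆⟪⟫ A x = ⟪⟫-closed A (^⊥-antitone (⟪⟫^⊥⊆⟪ᗮ⟫ A) x)

  ⟪ᗮ⟫⊆⟪⟫^⊥ (pos i)     = λ x → x
  ⟪ᗮ⟫⊆⟪⟫^⊥ (neg i)     = ⊆-^⊥^⊥
  ⟪ᗮ⟫⊆⟪⟫^⊥ 𝟏           = ⊆-^⊥^⊥
  ⟪ᗮ⟫⊆⟪⟫^⊥ ⊥           = λ x → x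
  ⟪ᗮ⟫⊆⟪⟫^⊥ ⊤           = λ x → x
  ⟪ᗮ⟫⊆⟪⟫^⊥ 𝟎           = ⊆-^⊥^⊥
  ⟪ᗮ⟫⊆⟪⟫^⊥ (A ⊗ B)     = λ x → ⊆-^⊥^⊥ (^⊥-antitone (·ˢ-mono (⟪⟫⊆⟪ᗮ⟫^⊥ B) (⟪⟫⊆⟪ᗮ⟫^⊥ A)) x)
  ⟪ᗮ⟫⊆⟪⟫^⊥ (A ⅋ B)     = ^⊥-antitone (^⊥-antitone (·ˢ-mono (⟪ᗮ⟫⊆⟪⟫^⊥ A) (⟪ᗮ⟫⊆⟪⟫^⊥ B)))
  ⟪ᗮ⟫⊆⟪⟫^⊥ (A & B)     = ^⊥-antitone (^⊥-antitone (∪ˢ-mono (⟪ᗮ⟫⊆⟪⟫^⊥ A) (⟪ᗮ⟫⊆⟪⟫^⊥ B)))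
  ⟪ᗮ⟫⊆⟪⟫^⊥ (A ⊕ B)     = λ x → ⊆-^⊥^⊥ (^⊥-antitone (∪ˢ-mono (⟪⟫⊆⟪ᗮ⟫^⊥ A) (⟪⟫⊆⟪ᗮ⟫^⊥ B)) x)
  ⟪ᗮ⟫⊆⟪⟫^⊥ (‼ s [ A ]) = λ x → ⊆-^⊥^⊥ (^⊥-antitone (∩ˢ-monoˡ (⟪⟫⊆⟪ᗮ⟫^⊥ A)) x)
  ⟪ᗮ⟫⊆⟪⟫^⊥ (⁇ s [ A ]) = ^⊥-antitone (^⊥-antitone (∩ˢ-monoˡ (⟪ᗮ⟫⊆⟪⟫^⊥ A)))

  ⟪⟫^⊥⊆⟪ᗮ⟫ (pos i)     = λ x → x
  ⟪⟫^⊥⊆⟪ᗮ⟫ (neg i)     = ^⊥^⊥^⊥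
  ⟪⟫^⊥⊆⟪ᗮ⟫ 𝟏           = ^⊥^⊥^⊥
  ⟪⟫^⊥⊆⟪ᗮ⟫ ⊥           = λ x → x
  ⟪⟫^⊥⊆⟪ᗮ⟫ ⊤           = λ x → x
  ⟪⟫^⊥⊆⟪ᗮ⟫ 𝟎           = λ _ → tt
  ⟪⟫^⊥⊆⟪ᗮ⟫ (A ⊗ B)     = λ x → ^⊥-antitone (·ˢ-mono (⟪ᗮ⟫^⊥⊆⟪⟫ B) (⟪ᗮ⟫^⊥⊆⟪⟫ A)) (^⊥^⊥^⊥ x)
  ⟪⟫^⊥⊆⟪ᗮ⟫ (A ⅋ B)     = ^⊥-antitone (^⊥-antitone (·ˢ-mono (⟪⟫^⊥⊆⟪ᗮ⟫ A) (⟪⟫^⊥⊆⟪ᗮ⟫ B)))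
  ⟪⟫^⊥⊆⟪ᗮ⟫ (A & B)     = ^⊥-antitone (^⊥-antitone (∪ˢ-mono (⟪⟫^⊥⊆⟪ᗮ⟫ A) (⟪⟫^⊥⊆⟪ᗮ⟫ B)))
  ⟪⟫^⊥⊆⟪ᗮ⟫ (A ⊕ B)     = λ x → ^⊥-antitone (∪ˢ-mono (⟪ᗮ⟫^⊥⊆⟪⟫ A) (⟪ᗮ⟫^⊥⊆⟪⟫ B)) (^⊥^⊥^⊥ x)
  ⟪⟫^⊥⊆⟪ᗮ⟫ (‼ s [ A ]) = λ x → ^⊥-antitone (∩ˢ-monoˡ (⟪ᗮ⟫^⊥⊆⟪⟫ A)) (^⊥^⊥^⊥ x)
  ⟪⟫^⊥⊆⟪ᗮ⟫ (⁇ s [ A ]) = ^⊥-antitone (^⊥-antitone (∩ˢ-monoˡ (⟪⟫^⊥⊆⟪ᗮ⟫ A)))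

  [?]-promotable : ∀ s A → Promotable s [ ⁇ s [ A ] ]
  [?]-promotable s A = [ s , A ] , refl , ≼.refl ∷ []

  ᗮ∈⟪⟫ : ∀ A → ⟪ A ⟫ [ A ᗮ ]
  ∈⟪⟫^⊥ : ∀ A → (⟪ A ⟫ ^⊥) [ A ]

  ᗮ∈⟪⟫ (pos i)     = orth λ { _ refl → ax }
  ᗮ∈⟪⟫ (neg i)     = ∈⟪⟫^⊥ (pos i)
  ᗮ∈⟪⟫ 𝟏           = orth λ Δ Δ∈ → front-to-last (⊥r (pair Δ∈ [] refl))
  ᗮ∈⟪⟫ ⊥           = orth λ { _ refl → 𝟏r }
  ᗮ∈⟪⟫ ⊤           = tt
  ᗮ∈⟪⟫ 𝟎           = orth λ _ _ → front-to-last ⊤r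
  ᗮ∈⟪⟫ (A ⊗ B)     = orth λ Δ Δ∈ → front-to-last (⅋r (pair Δ∈ (B ᗮ ∷ A ᗮ ∷ []) (ᗮ∈⟪⟫ B ++ˢ ᗮ∈⟪⟫ A)))
  ᗮ∈⟪⟫ (A ⅋ B)     = orth λ { _ (_++ˢ_ {Γ} {Δ} Γ∈ Δ∈) →
    rotate-≡ (Δ ++ [ (B ᗮ) ⊗ (A ᗮ) ]) Γ (sym (++-assoc Δ _ Γ)) (sym (++-assoc Γ Δ _))
      (⊗r (front-to-last (pair Δ∈ [ B ᗮ ] (ᗮ∈⟪⟫ B))) (pair Γ∈ [ A ᗮ ] (ᗮ∈⟪⟫ A))) }
  ᗮ∈⟪⟫ (A & B)     = orth λ { _ (left Γ∈)  → front-to-last (⊕r₁ (pair Γ∈ [ A ᗮ ] (ᗮ∈⟪⟫ A)))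
                            ; _ (right Γ∈) → front-to-last (⊕r₂ (pair Γ∈ [ B ᗮ ] (ᗮ∈⟪⟫ B))) }
  ᗮ∈⟪⟫ (A ⊕ B)     = orth λ Δ Δ∈ → front-to-last
    (&r (pair Δ∈ [ A ᗮ ] (left (ᗮ∈⟪⟫ A))) (pair Δ∈ [ B ᗮ ] (right (ᗮ∈⟪⟫ B))))
  ᗮ∈⟪⟫ (‼ s [ A ]) = orth λ Δ Δ∈ → front-to-last (pair Δ∈ [ ⁇ s [ A ᗮ ] ] (?A∈ , [?]-promotable s (A ᗮ)))
    where
    ?A∈ : ⟪ A ⟫ [ ⁇ s [ A ᗮ ] ]
    ?A∈ = ⟪⟫-closed A (orth λ Δ Δ∈ → front-to-last (?r (pair Δ∈ [ A ᗮ ] (ᗮ∈⟪⟫ A))))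
  ᗮ∈⟪⟫ (⁇ s [ A ]) = orth λ { _ (Γ∈ , (qs , refl , s≼qs)) → front-to-last (!r s≼qs (pair Γ∈ [ A ᗮ ] (ᗮ∈⟪⟫ A))) }

  ∈⟪⟫^⊥ (pos i)     = orth λ Γ Γ∈ → front-to-last (pair Γ∈ [ pos i ] refl)
  ∈⟪⟫^⊥ (neg i)     = orth λ Γ Γ∈ → front-to-last (pair Γ∈ [ neg i ] (ᗮ∈⟪⟫ (pos i)))
  ∈⟪⟫^⊥ 𝟏           = orth λ Γ Γ∈ → front-to-last (pair Γ∈ [ 𝟏 ] (orth λ { _ refl → 𝟏r }))
  ∈⟪⟫^⊥ ⊥           = orth λ Γ Γ∈ → front-to-last (⊥r (pair Γ∈ [] refl))
  ∈⟪⟫^⊥ ⊤           = orth λ _ _ → front-to-last ⊤r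
  ∈⟪⟫^⊥ 𝟎           = orth λ Γ Γ∈ → front-to-last (pair Γ∈ [ 𝟎 ] tt)
  ∈⟪⟫^⊥ (A ⊗ B)     = orth λ Γ Γ∈ → front-to-last (pair Γ∈ [ A ⊗ B ] ⊗∈)
    where
    ⊗∈ : ((⟪ B ⟫ ·ˢ ⟪ A ⟫) ^⊥) [ A ⊗ B ]
    ⊗∈ = orth λ { _ (_++ˢ_ {Δ} {Γ} Δ∈ Γ∈) →
      rotate-≡ (Γ ++ [ A ⊗ B ]) Δ (sym (++-assoc Γ _ Δ)) (sym (++-assoc Δ Γ _))
        (⊗r (pair (∈⟪⟫^⊥ A) Γ Γ∈) (last-to-front (pair (∈⟪⟫^⊥ B) Δ Δ∈))) }
  ∈⟪⟫^⊥ (A ⅋ B)     = orth λ Γ Γ∈ → front-to-last (⅋r (pair Γ∈ (A ∷ B ∷ []) (∈⟪⟫^⊥ A ++ˢ ∈⟪⟫^⊥ B)))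
  ∈⟪⟫^⊥ (A & B)     = orth λ Γ Γ∈ → front-to-last
    (&r (pair Γ∈ [ A ] (left (∈⟪⟫^⊥ A))) (pair Γ∈ [ B ] (right (∈⟪⟫^⊥ B))))
  ∈⟪⟫^⊥ (A ⊕ B)     = orth λ Γ Γ∈ → front-to-last (pair Γ∈ [ A ⊕ B ] ⊕∈)
    where
    ⊕∈ : ((⟪ A ⟫ ∪ˢ ⟪ B ⟫) ^⊥) [ A ⊕ B ]
    ⊕∈ = orth λ { Δ (left Δ∈)  → front-to-last (⊕r₁ (last-to-front (pair (∈⟪⟫^⊥ A) Δ Δ∈)))
               ; Δ (right Δ∈) → front-to-last (⊕r₂ (last-to-front (pair (∈⟪⟫^⊥ B) Δ Δ∈))) }
  ∈⟪⟫^⊥ (‼ s [ A ]) = orth λ Γ Γ∈ → front-to-last (pair Γ∈ [ ‼ s [ A ] ] !∈)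
    where
    !∈ : ((⟪ A ⟫ ∩ˢ Promotable s) ^⊥) [ ‼ s [ A ] ]
    !∈ = orth λ { _ (Δ∈ , (qs , refl , s≼qs)) → front-to-last (!r s≼qs (last-to-front (pair (∈⟪⟫^⊥ A) _ Δ∈))) }
  ∈⟪⟫^⊥ (⁇ s [ A ]) = orth λ Γ Γ∈ → front-to-last (pair Γ∈ [ ⁇ s [ A ] ] (?∈ , [?]-promotable s A))
    where
    ?∈ : (⟪ A ⟫ ^⊥) [ ⁇ s [ A ] ]
    ?∈ = orth λ Δ Δ∈ → front-to-last (?r (last-to-front (pair (∈⟪⟫^⊥ A) Δ Δ∈)))

  data Tests : List (CFm Label) → List (CFm Label) → Set where
    []  : Tests [] []
    _∷_ : ∀ {A Γ x w} → (⟪ A ⟫ ^⊥) x → Tests Γ w → Tests (A ∷ Γ) (x ++ w)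

  Valid : List (CFm Label) → Set
  Valid Γ = ∀ {w} → Tests Γ w → ⊢ w

  tests-++⁻ : ∀ Γ {Δ w} → Tests (Γ ++ Δ) w → ∃₂ λ u v → w ≡ u ++ v × Tests Γ u × Tests Δ v
  tests-++⁻ []      t                  = [] , _ , refl , [] , t
  tests-++⁻ (A ∷ Γ) (_∷_ {x = x} x∈ t) with u , v , refl , tΓ , tΔ ← tests-++⁻ Γ t =
    x ++ u , v , sym (++-assoc x u v) , x∈ ∷ tΓ , tΔ

  tests-++⁺ : ∀ {Γ Δ u v} → Tests Γ u → Tests Δ v → Tests (Γ ++ Δ) (u ++ v)
  tests-++⁺         []                         t′ = t′
  tests-++⁺ {v = v} (_∷_ {x = x} {w = u} x∈ t) t′ =
    subst (Tests _) (sym (++-assoc x u v)) (x∈ ∷ tests-++⁺ t t′)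

  tests-self : ∀ Γ → Tests Γ Γ
  tests-self []      = []
  tests-self (A ∷ Γ) = ∈⟪⟫^⊥ A ∷ tests-self Γ

  valid-rotate : ∀ Γ Δ → Valid (Γ ++ Δ) → Valid (Δ ++ Γ)
  valid-rotate Γ Δ valid t with v , u , refl , tΔ , tΓ ← tests-++⁻ Δ t =
    rotate u v (valid (tests-++⁺ tΓ tΔ))

  valid-head : ∀ {A Γ w} → Valid (A ∷ Γ) → Tests Γ w → ⟪ A ⟫ w
  valid-head {A} valid t = ⟪⟫-closed A (orth λ x x∈ → valid (x∈ ∷ t))

  valid-∷ : ∀ {A Γ} → (∀ {w} → Tests Γ w → ⟪ A ⟫ w) → Valid (A ∷ Γ)
  valid-∷ f (_∷_ {x = x} {w = w} x∈ t) = rotate w x (pair x∈ w (f t))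

  valid-ax : ∀ A → Valid (A ∷ A ᗮ ∷ [])
  valid-ax A = valid-∷ λ { (_∷_ {x = x} x∈ []) →
    subst ⟪ A ⟫ (sym (++-identityʳ x)) (⟪ᗮ⟫^⊥⊆⟪⟫ A x∈) }

  valid-⊗r : ∀ {Γ Δ A B} → Valid (Γ ++ [ A ]) → Valid (B ∷ Δ) → Valid (Γ ++ A ⊗ B ∷ Δ)
  valid-⊗r {Γ} {Δ} {A} {B} validA validB = valid-rotate (A ⊗ B ∷ Δ) Γ (valid-∷ λ t →
    let v , u , eq , tΔ , tΓ = tests-++⁻ Δ t in
    subst ⟪ A ⊗ B ⟫ (sym eq)
      (⊆-^⊥^⊥ (valid-head validB tΔ ++ˢ valid-head (valid-rotate Γ [ A ] validA) tΓ)))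

  valid-⅋r : ∀ {Γ A B} → Valid (A ∷ B ∷ Γ) → Valid (A ⅋ B ∷ Γ)
  valid-⅋r valid = valid-∷ λ {w} t → orth λ { _ (_++ˢ_ {x} {y} x∈ y∈) →
    cast (sym (++-assoc x y w)) (valid (x∈ ∷ y∈ ∷ t)) }

  valid-&r : ∀ {Γ A B} → Valid (A ∷ Γ) → Valid (B ∷ Γ) → Valid (A & B ∷ Γ)
  valid-&r validA validB = valid-∷ λ t → orth λ { _ (left x∈)  → validA (x∈ ∷ t)
                                                ; _ (right y∈) → validB (y∈ ∷ t) }

  valid-⊕r₁ : ∀ {Γ A B} → Valid (A ∷ Γ) → Valid (A ⊕ B ∷ Γ)
  valid-⊕r₁ valid = valid-∷ λ t → ⊆-^⊥^⊥ (left (valid-head valid t))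

  valid-⊕r₂ : ∀ {Γ A B} → Valid (B ∷ Γ) → Valid (A ⊕ B ∷ Γ)
  valid-⊕r₂ valid = valid-∷ λ t → ⊆-^⊥^⊥ (right (valid-head valid t))

  valid-𝟏r : Valid [ 𝟏 ]
  valid-𝟏r = valid-∷ λ { [] → ⊆-^⊥^⊥ refl }

  valid-⊥r : ∀ {Γ} → Valid Γ → Valid (⊥ ∷ Γ)
  valid-⊥r valid = valid-∷ λ t → orth λ { _ refl → valid t }

  valid-⊤r : ∀ {Γ} → Valid (⊤ ∷ Γ)
  valid-⊤r = valid-∷ λ _ → tt

  valid-?r : ∀ {Γ s A} → Valid (A ∷ Γ) → Valid (⁇ s [ A ] ∷ Γ)
  valid-?r valid = valid-∷ λ t → orth λ { _ (x∈ , _) → valid (x∈ ∷ t) }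

  valid-weak : ∀ {Γ s A} → W s → Valid Γ → Valid (⁇ s [ A ] ∷ Γ)
  valid-weak w valid = valid-∷ λ t → orth λ { _ (_ , (qs , refl , s≼qs)) →
    weaken-all (All.map (λ s≼t → W-up s≼t w) s≼qs) (valid t) }

  valid-ncontr : ∀ {Γ Δ s A} → C s → Valid (⁇ s [ A ] ∷ Γ ++ ⁇ s [ A ] ∷ Δ) → Valid (⁇ s [ A ] ∷ Γ ++ Δ)
  valid-ncontr {Γ} c valid = valid-∷ λ t → let u , v , eq , tΓ , tΔ = tests-++⁻ Γ t in
    orth λ { _ x∈@(_ , (qs , refl , s≼qs)) → cast (cong (whynots Σ qs ++_) (sym eq))
      (contract-all u v (All.map (λ s≼t → C-up s≼t c) s≼qs)
        (valid (⊆-^⊥^⊥ x∈ ∷ tests-++⁺ tΓ (⊆-^⊥^⊥ x∈ ∷ tΔ)))) }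

  valid-ex : ∀ {Γ Δ s A} → E s → Valid (Γ ++ ⁇ s [ A ] ∷ Δ) → Valid (⁇ s [ A ] ∷ Γ ++ Δ)
  valid-ex {Γ} e valid = valid-∷ λ t → let u , v , eq , tΓ , tΔ = tests-++⁻ Γ t in
    orth λ { _ x∈@(_ , (qs , refl , s≼qs)) → cast (cong (whynots Σ qs ++_) (sym eq))
      (exchange-all u v (All.map (λ s≼t → E-up s≼t e) s≼qs)
        (valid (tests-++⁺ tΓ (⊆-^⊥^⊥ x∈ ∷ tΔ)))) }

  valid-cut : ∀ {Γ Δ A} → Valid (Γ ++ [ A ᗮ ]) → Valid (A ∷ Δ) → Valid (Γ ++ Δ)
  valid-cut {Γ} {Δ} {A} validAᗮ validA t with u , v , refl , tΓ , tΔ ← tests-++⁻ Γ t =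
    rotate v u (pair (⟪ᗮ⟫⊆⟪⟫^⊥ A (valid-head (valid-rotate Γ [ A ᗮ ] validAᗮ) tΓ)) v (valid-head validA tΔ))

  data StrictTests : List (Label × CFm Label) → List (CFm Label) → Set where
    []  : StrictTests [] []
    _∷_ : ∀ {t A qs x w} → (⟪ A ⟫ ^⊥ ∩ˢ Promotable t) x → StrictTests qs w → StrictTests ((t , A) ∷ qs) (x ++ w)

  strict⇒tests : ∀ {qs w} → StrictTests qs w → Tests (whynots Σ qs) w
  strict⇒tests []      = []
  strict⇒tests (x∈ ∷ st) = ⊆-^⊥^⊥ x∈ ∷ strict⇒tests st

  promotable-++ : ∀ {s Γ Δ} → Promotable s Γ → Promotable s Δ → Promotable s (Γ ++ Δ)
  promotable-++ (qs , refl , s≼qs) (rs , refl , s≼rs) = qs ++ rs , sym (map-++ _ qs rs) , All.++⁺ s≼qs s≼rs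

  strict⇒promotable : ∀ {s qs w} → All (λ q → s ≼ proj₁ q) qs → StrictTests qs w → Promotable s w
  strict⇒promotable []            []                                = [] , refl , []
  strict⇒promotable (s≼t ∷ s≼qs) ((_ , (rs , refl , t≼rs)) ∷ st) =
    promotable-++ (rs , refl , All.map (≼.trans s≼t) t≼rs) (strict⇒promotable s≼qs st)

  -- ⟪ ⁇ t [ A ] ⟫ ^⊥ is the closure of ⟪ A ⟫ ^⊥ ∩ˢ Promotable t, so it is
  -- enough to test the ?-formulas with elements of the latter.
  strictTests-suffice : ∀ qs pre → (∀ {w} → StrictTests qs w → ⊢ pre ++ w) →
    ∀ {w} → Tests (whynots Σ qs) w → ⊢ pre ++ w
  strictTests-suffice []             pre H []                                 = H []
  strictTests-suffice ((t , A) ∷ qs) pre H (_∷_ {x = x} {w = w} x∈ t′) =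
    cast (++-assoc pre x w) (strictTests-suffice qs (pre ++ x) H′ t′)
    where
    H′ : ∀ {v} → StrictTests qs v → ⊢ (pre ++ x) ++ v
    H′ {v} st = rotate-≡ v (pre ++ x) (++-assoc v pre x) refl
      (pair x∈ (v ++ pre) (orth λ y y∈ →
        rotate-≡ pre (y ++ v) refl (++-assoc y v pre) (H (y∈ ∷ st))))

  valid-!r : ∀ {qs s B} → All (λ q → s ≼ proj₁ q) qs → Valid (B ∷ whynots Σ qs) → Valid (‼ s [ B ] ∷ whynots Σ qs)
  valid-!r {qs} s≼qs valid (_∷_ {x = z} z∈ t) = strictTests-suffice qs z
    (λ {w} st → rotate w z (pair (^⊥^⊥^⊥ z∈) w (valid-head valid (strict⇒tests st) , strict⇒promotable s≼qs st)))
    t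

  valid : ∀ {c Γ} → SCLL Σ c Γ → Valid Γ
  valid (rot {Γ₁ = Γ₁} {Γ₂} d) = valid-rotate Γ₁ Γ₂ (valid d)
  valid (ax {A = A})           = valid-ax A
  valid (⊗r d e)               = valid-⊗r (valid d) (valid e)
  valid (⅋r d)                 = valid-⅋r (valid d)
  valid (&r d e)               = valid-&r (valid d) (valid e)
  valid (⊕r₁ d)                = valid-⊕r₁ (valid d)
  valid (⊕r₂ d)                = valid-⊕r₂ (valid d)
  valid 𝟏r                     = valid-𝟏r
  valid (⊥r d)                 = valid-⊥r (valid d)
  valid ⊤r                     = valid-⊤r
  valid (!r s≼qs d)            = valid-!r s≼qs (valid d)
  valid (?r d)                 = valid-?r (valid d)
  valid (weak w d)             = valid-weak w (valid d)
  valid (ncontr c d)           = valid-ncontr c (valid d)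
  valid (ex e d)               = valid-ex e (valid d)
  valid (cut _ d e)            = valid-cut (valid d) (valid e)

  cutElimination : ∀ {c Γ} → SCLL Σ c Γ → SCLL Σ false Γ
  cutElimination d = valid d (tests-self _)

-- Pos a X and Neg a X say a ≡ ⟦ X ⟧ and a ≡ ⟦ X ⟧ ᗮ, as relations that can be
-- inverted by pattern matching on a.
module Polarity {L : Set} where

  mutual
    data Pos : CFm L → LFm L → Set where
      pos-var : ∀ {i} → Pos (pos i) (var i)
      pos-𝟏   : Pos 𝟏 𝟏
      pos-·   : ∀ {a b A B} → Pos a A → Pos b B → Pos (a ⊗ b) (A · B)
      pos-∖   : ∀ {a b A B} → Neg a A → Pos b B → Pos (a ⅋ b) (A ∖ B)
      pos-⁄   : ∀ {a b A B} → Pos b B → Neg a A → Pos (b ⅋ a) (B ⁄ A)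
      pos-∧   : ∀ {a b A B} → Pos a A → Pos b B → Pos (a & b) (A ∧ B)
      pos-∨   : ∀ {a b A B} → Pos a A → Pos b B → Pos (a ⊕ b) (A ∨ B)
      pos-!   : ∀ {a A s} → Pos a A → Pos (‼ s [ a ]) (! s [ A ])

    data Neg : CFm L → LFm L → Set where
      neg-var : ∀ {i} → Neg (neg i) (var i)
      neg-𝟏   : Neg ⊥ 𝟏
      neg-·   : ∀ {a b A B} → Neg b B → Neg a A → Neg (b ⅋ a) (A · B)
      neg-∖   : ∀ {a b A B} → Neg b B → Pos a A → Neg (b ⊗ a) (A ∖ B)
      neg-⁄   : ∀ {a b A B} → Pos a A → Neg b B → Neg (a ⊗ b) (B ⁄ A)
      neg-∧   : ∀ {a b A B} → Neg a A → Neg b B → Neg (a ⊕ b) (A ∧ B)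
      neg-∨   : ∀ {a b A B} → Neg a A → Neg b B → Neg (a & b) (A ∨ B)
      neg-!   : ∀ {a A s} → Neg a A → Neg (⁇ s [ a ]) (! s [ A ])

  pos-neg-disjoint : ∀ {a X Y} → Pos a X → ¬ Neg a Y
  pos-neg-disjoint (pos-· p q) (neg-∖ n m) = pos-neg-disjoint p n
  pos-neg-disjoint (pos-· p q) (neg-⁄ m n) = pos-neg-disjoint q n
  pos-neg-disjoint (pos-∖ n p) (neg-· m q) = pos-neg-disjoint p q
  pos-neg-disjoint (pos-⁄ p n) (neg-· m q) = pos-neg-disjoint p m
  pos-neg-disjoint (pos-∧ p q) (neg-∨ n m) = pos-neg-disjoint p n
  pos-neg-disjoint (pos-∨ p q) (neg-∧ n m) = pos-neg-disjoint p n

  pos-unique : ∀ {a X Y} → Pos a X → Pos a Y → X ≡ Y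
  neg-unique : ∀ {a X Y} → Neg a X → Neg a Y → X ≡ Y
  pos-unique pos-var     pos-var       = refl
  pos-unique pos-𝟏       pos-𝟏         = refl
  pos-unique (pos-· p q) (pos-· p′ q′) = cong₂ _·_ (pos-unique p p′) (pos-unique q q′)
  pos-unique (pos-∖ n p) (pos-∖ n′ p′) = cong₂ _∖_ (neg-unique n n′) (pos-unique p p′)
  pos-unique (pos-∖ n p) (pos-⁄ p′ n′) = ⊥-elim (pos-neg-disjoint p′ n)
  pos-unique (pos-⁄ p n) (pos-∖ n′ p′) = ⊥-elim (pos-neg-disjoint p n′)
  pos-unique (pos-⁄ p n) (pos-⁄ p′ n′) = cong₂ _⁄_ (pos-unique p p′) (neg-unique n n′)
  pos-unique (pos-∧ p q) (pos-∧ p′ q′) = cong₂ _∧_ (pos-unique p p′) (pos-unique q q′)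
  pos-unique (pos-∨ p q) (pos-∨ p′ q′) = cong₂ _∨_ (pos-unique p p′) (pos-unique q q′)
  pos-unique (pos-! p)   (pos-! p′)    = cong ! _ [_] (pos-unique p p′)
  neg-unique neg-var     neg-var       = refl
  neg-unique neg-𝟏       neg-𝟏         = refl
  neg-unique (neg-· n m) (neg-· n′ m′) = cong₂ _·_ (neg-unique m m′) (neg-unique n n′)
  neg-unique (neg-∖ n p) (neg-∖ n′ p′) = cong₂ _∖_ (pos-unique p p′) (neg-unique n n′)
  neg-unique (neg-∖ n p) (neg-⁄ p′ n′) = ⊥-elim (pos-neg-disjoint p′ n)
  neg-unique (neg-⁄ p n) (neg-∖ n′ p′) = ⊥-elim (pos-neg-disjoint p n′)
  neg-unique (neg-⁄ p n) (neg-⁄ p′ n′) = cong₂ _⁄_ (neg-unique n n′) (pos-unique p p′)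
  neg-unique (neg-∧ n m) (neg-∧ n′ m′) = cong₂ _∧_ (neg-unique n n′) (neg-unique m m′)
  neg-unique (neg-∨ n m) (neg-∨ n′ m′) = cong₂ _∨_ (neg-unique n n′) (neg-unique m m′)
  neg-unique (neg-! n)   (neg-! n′)    = cong ! _ [_] (neg-unique n n′)

  pos-ᗮ : ∀ {a X} → Pos a X → Neg (a ᗮ) X
  neg-ᗮ : ∀ {a X} → Neg a X → Pos (a ᗮ) X
  pos-ᗮ pos-var     = neg-var
  pos-ᗮ pos-𝟏       = neg-𝟏
  pos-ᗮ (pos-· p q) = neg-· (pos-ᗮ q) (pos-ᗮ p)
  pos-ᗮ (pos-∖ n p) = neg-∖ (pos-ᗮ p) (neg-ᗮ n)
  pos-ᗮ (pos-⁄ p n) = neg-⁄ (neg-ᗮ n) (pos-ᗮ p)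
  pos-ᗮ (pos-∧ p q) = neg-∧ (pos-ᗮ p) (pos-ᗮ q)
  pos-ᗮ (pos-∨ p q) = neg-∨ (pos-ᗮ p) (pos-ᗮ q)
  pos-ᗮ (pos-! p)   = neg-! (pos-ᗮ p)
  neg-ᗮ neg-var     = pos-var
  neg-ᗮ neg-𝟏       = pos-𝟏
  neg-ᗮ (neg-· n m) = pos-· (neg-ᗮ m) (neg-ᗮ n)
  neg-ᗮ (neg-∖ n p) = pos-∖ (pos-ᗮ p) (neg-ᗮ n)
  neg-ᗮ (neg-⁄ p n) = pos-⁄ (neg-ᗮ n) (pos-ᗮ p)
  neg-ᗮ (neg-∧ n m) = pos-∧ (neg-ᗮ n) (neg-ᗮ m)
  neg-ᗮ (neg-∨ n m) = pos-∨ (neg-ᗮ n) (neg-ᗮ m)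
  neg-ᗮ (neg-! n)   = pos-! (neg-ᗮ n)

  pos-⟦⟧ : ∀ X → Pos ⟦ X ⟧ X
  pos-⟦⟧ (var i)     = pos-var
  pos-⟦⟧ 𝟏           = pos-𝟏
  pos-⟦⟧ (A · B)     = pos-· (pos-⟦⟧ A) (pos-⟦⟧ B)
  pos-⟦⟧ (A ∖ B)     = pos-∖ (pos-ᗮ (pos-⟦⟧ A)) (pos-⟦⟧ B)
  pos-⟦⟧ (B ⁄ A)     = pos-⁄ (pos-⟦⟧ B) (pos-ᗮ (pos-⟦⟧ A))
  pos-⟦⟧ (A ∧ B)     = pos-∧ (pos-⟦⟧ A) (pos-⟦⟧ B)
  pos-⟦⟧ (A ∨ B)     = pos-∨ (pos-⟦⟧ A) (pos-⟦⟧ B)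
  pos-⟦⟧ (! s [ A ]) = pos-! (pos-⟦⟧ A)

  -- Negs Γ Xs says Γ ≡ ⟦ Xs ⟧ᗮ.
  data Negs : List (CFm L) → List (LFm L) → Set where
    []  : Negs [] []
    _∷_ : ∀ {a X Γ Xs} → Neg a X → Negs Γ Xs → Negs (a ∷ Γ) (Xs ++ [ X ])

  negs-++⁻ : ∀ U {V P} → Negs (U ++ V) P → ∃₂ λ Pu Pv → P ≡ Pv ++ Pu × Negs U Pu × Negs V Pv
  negs-++⁻ []      {P = P} ns = [] , P , sym (++-identityʳ P) , [] , ns
  negs-++⁻ (a ∷ U) (_∷_ {X = X} n ns) with Pu , Pv , refl , nsU , nsV ← negs-++⁻ U ns =
    Pu ++ [ X ] , Pv , ++-assoc Pv Pu [ X ] , n ∷ nsU , nsV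

  negs-++⁺ : ∀ {U V Pu Pv} → Negs U Pu → Negs V Pv → Negs (U ++ V) (Pv ++ Pu)
  negs-++⁺ {Pv = Pv} []                              nsV = subst (Negs _) (sym (++-identityʳ Pv)) nsV
  negs-++⁺ {Pv = Pv} (_∷_ {X = X} {Xs = Xs} n nsU) nsV =
    subst (Negs _) (++-assoc Pv Xs [ X ]) (n ∷ negs-++⁺ nsU nsV)

  negs-unique : ∀ {Γ P P′} → Negs Γ P → Negs Γ P′ → P ≡ P′
  negs-unique []       []         = refl
  negs-unique (n ∷ ns) (n′ ∷ ns′) = cong₂ (λ Xs X → Xs ++ [ X ]) (negs-unique ns ns′) (neg-unique n n′)

  negs-∷ʳ : ∀ {Γ Xs a X} → Negs Γ Xs → Neg a X → Negs (Γ ++ [ a ]) (X ∷ Xs)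
  negs-∷ʳ []       n = n ∷ []
  negs-∷ʳ (m ∷ ns) n = m ∷ negs-∷ʳ ns n

  negs-⟦⟧ᗮ : ∀ Π → Negs ⟦ Π ⟧ᗮ Π
  negs-⟦⟧ᗮ []      = []
  negs-⟦⟧ᗮ (X ∷ Π) = subst (λ Γ → Negs Γ (X ∷ Π)) (sym (⟦⟧ᗮ-++ [ X ] Π)) (negs-∷ʳ (negs-⟦⟧ᗮ Π) (pos-ᗮ (pos-⟦⟧ X)))

  negs-all : ∀ {Γ P} → Negs Γ P → All (λ a → ∃ (Neg a)) Γ
  negs-all []       = []
  negs-all (n ∷ ns) = (_ , n) ∷ negs-all ns

  Polarized : CFm L → Set
  Polarized a = ∃ (Pos a) ⊎ ∃ (Neg a)

  translation-polarized : ∀ Π B → All Polarized (⟦ Π ⟧ᗮ ++ [ ⟦ B ⟧ ])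
  translation-polarized Π B = All.++⁺ (All.map inj₂ (negs-all (negs-⟦⟧ᗮ Π))) (inj₁ (_ , pos-⟦⟧ B) ∷ [])

  positive-unique : ∀ {N₁ b N₂ U a V P₁ P₂ A} → N₁ ++ b ∷ N₂ ≡ U ++ a ∷ V → Pos a A →
    Negs N₁ P₁ → Negs N₂ P₂ → N₁ ≡ U × b ≡ a × N₂ ≡ V
  positive-unique {N₁} {b} {N₂} {U} {a} {V} eq p ns₁ ns₂ with ++-≡-++ N₁ (b ∷ N₂) U (a ∷ V) eq
  ... | inj₁ ([] , refl , refl)     = sym (++-identityʳ N₁) , refl , refl
  ... | inj₁ (_ ∷ M , refl , refl)  = ⊥-elim (pos-neg-disjoint p (proj₂ (All.head (All.++⁻ʳ M (negs-all ns₂)))))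
  ... | inj₂ ([] , refl , refl)     = ++-identityʳ U , refl , refl
  ... | inj₂ (_ ∷ M , refl , refl)  = ⊥-elim (pos-neg-disjoint p (proj₂ (All.head (All.++⁻ʳ U (negs-all ns₁)))))

  negative-position : ∀ {N₁ b N₂ U a V A B} → N₁ ++ b ∷ N₂ ≡ U ++ a ∷ V → Pos b B → Neg a A →
    (∃ λ M → U ≡ N₁ ++ b ∷ M × N₂ ≡ M ++ a ∷ V) ⊎ (∃ λ M → N₁ ≡ U ++ a ∷ M × V ≡ M ++ b ∷ N₂)
  negative-position {N₁} {b} {N₂} {U} {a} {V} eq p n with ++-≡-++ N₁ (b ∷ N₂) U (a ∷ V) eq
  ... | inj₁ ([] , _ , refl)       = ⊥-elim (pos-neg-disjoint p n)
  ... | inj₁ (_ ∷ M , eqU , refl)  = inj₁ (M , eqU , refl)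
  ... | inj₂ ([] , _ , refl)       = ⊥-elim (pos-neg-disjoint p n)
  ... | inj₂ (_ ∷ M , eqN₁ , refl) = inj₂ (M , eqN₁ , refl)

module Conservativity (Σ : SubexpSig) where
  open SubexpSig Σ
  open Polarity

  infix 4 _⊢ᴸ_
  _⊢ᴸ_ : List (LFm Label) → LFm Label → Set
  Π ⊢ᴸ B = SMALC Σ false Π B

  castᴸ : ∀ {Π Π′ B} → Π ≡ Π′ → Π ⊢ᴸ B → Π′ ⊢ᴸ B
  castᴸ {B = B} = subst (_⊢ᴸ B)

  -- a rotation N₁ ++ b ∷ N₂ of the translation of a derivable P₁ ++ P₂ ⊢ᴸ B
  data Lambek (Γ : List (CFm Label)) : Set where
    lambek : ∀ {N₁ b N₂ B P₁ P₂} → Γ ≡ N₁ ++ b ∷ N₂ → Pos b B → Negs N₁ P₁ → Negs N₂ P₂ →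
             P₁ ++ P₂ ⊢ᴸ B → Lambek Γ

  -- the sequent ⟦ Ys ⟧ᗮ ++ V, decoded with Ys as one block of the antecedent
  data LambekWith (Ys : List (LFm Label)) (V : List (CFm Label)) : Set where
    lambekWith : ∀ {V₁ b V₂ B P₁ P₂} → V ≡ V₁ ++ b ∷ V₂ → Pos b B → Negs V₁ P₁ → Negs V₂ P₂ →
                 P₁ ++ Ys ++ P₂ ⊢ᴸ B → LambekWith Ys V

  lambek-rotate : ∀ Γ₁ {Γ₂} → Lambek (Γ₁ ++ Γ₂) → Lambek (Γ₂ ++ Γ₁)
  lambek-rotate Γ₁ {Γ₂} (lambek {N₁} {b} {N₂} {P₂ = P₂} eq p ns₁ ns₂ d) with ++-≡-++ Γ₁ Γ₂ N₁ (b ∷ N₂) eq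
  ... | inj₁ (M , refl , refl) with Pγ , Pm , refl , nsΓ , nsM ← negs-++⁻ Γ₁ ns₁ =
    lambek (++-assoc M (b ∷ N₂) Γ₁) p nsM (negs-++⁺ ns₂ nsΓ) (castᴸ (++-assoc Pm Pγ P₂) d)
  ... | inj₂ ([] , refl , refl) =
    lambek refl p [] (negs-++⁺ ns₂ (subst (λ N → Negs N _) (sym (++-identityʳ N₁)) ns₁)) d
  ... | inj₂ (_ ∷ M , refl , refl) with Pm , Pγ , refl , nsM , nsΓ ← negs-++⁻ M ns₂ =
    lambek (sym (++-assoc Γ₂ N₁ (b ∷ M))) p (negs-++⁺ nsΓ ns₁) nsM (castᴸ (sym (++-assoc _ Pγ Pm)) d)

  lambek-at : ∀ U {a V A} → Lambek (U ++ a ∷ V) → Pos a A →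
    ∃₂ λ Pu Pv → Negs U Pu × Negs V Pv × Pu ++ Pv ⊢ᴸ A
  lambek-at U (lambek eq p ns₁ ns₂ d) pₐ with refl , refl , refl ← positive-unique (sym eq) pₐ ns₁ ns₂
    with refl ← pos-unique p pₐ = _ , _ , ns₁ , ns₂ , d

  lambek-head : ∀ {a V A} → Lambek (a ∷ V) → Pos a A → ∃ λ P → Negs V P × P ⊢ᴸ A
  lambek-head l p with _ , P , [] , ns , d ← lambek-at [] l p = P , ns , d

  lambek-unfocus : ∀ {U V Ys} → Negs U Ys → LambekWith Ys V → Lambek (U ++ V)
  lambek-unfocus {U} {Ys = Ys} nsU (lambekWith {V₁} {b} {V₂} {P₁ = P₁} {P₂} refl p ns₁ ns₂ d) =
    lambek (sym (++-assoc U V₁ (b ∷ V₂))) p (negs-++⁺ nsU ns₁) ns₂ (castᴸ (sym (++-assoc P₁ Ys P₂)) d)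

  lambek-focus : ∀ U {V Ys} → Lambek (U ++ V) → Negs U Ys → LambekWith Ys V
  lambek-focus U {V} (lambek {N₁} {b} {N₂} {P₂ = P₂} eq p ns₁ ns₂ d) nsU with ++-≡-++ U V N₁ (b ∷ N₂) eq
  ... | inj₁ (M , refl , refl) with Pu , Pm , refl , nsU′ , nsM ← negs-++⁻ U ns₁
    with refl ← negs-unique nsU′ nsU = lambekWith refl p nsM ns₂ (castᴸ (++-assoc Pm Pu P₂) d)
  ... | inj₂ ([] , refl , refl) with refl ← negs-unique (subst (λ N → Negs N _) (sym (++-identityʳ N₁)) ns₁) nsU =
    lambekWith refl p [] ns₂ d
  ... | inj₂ (_ ∷ M , refl , refl) =
    ⊥-elim (pos-neg-disjoint p (proj₂ (All.head (All.++⁻ʳ N₁ (negs-all nsU)))))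

  lambekWith-map : ∀ {V Ys Zs} → (∀ {P₁ P₂ B} → P₁ ++ Ys ++ P₂ ⊢ᴸ B → P₁ ++ Zs ++ P₂ ⊢ᴸ B) →
    LambekWith Ys V → LambekWith Zs V
  lambekWith-map f (lambekWith {P₁ = P₁} {P₂} eq p ns₁ ns₂ d) = lambekWith eq p ns₁ ns₂ (f {P₁} {P₂} d)

  lambekWith-merge : ∀ {V Ys Zs Ws} →
    (∀ {P₁ P₂ B} → P₁ ++ Ys ++ P₂ ⊢ᴸ B → P₁ ++ Zs ++ P₂ ⊢ᴸ B → P₁ ++ Ws ++ P₂ ⊢ᴸ B) →
    LambekWith Ys V → LambekWith Zs V → LambekWith Ws V
  lambekWith-merge f (lambekWith {P₁ = P₁} {P₂} refl p ns₁ ns₂ d) (lambekWith eq′ p′ ns₁′ ns₂′ d′)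
    with refl , refl , refl ← positive-unique eq′ p′ ns₁ ns₂
    with refl ← pos-unique p p′ | refl ← negs-unique ns₁ ns₁′ | refl ← negs-unique ns₂ ns₂′ =
    lambekWith refl p ns₁ ns₂ (f {P₁} {P₂} d d′)

  negs-whynots : ∀ {s} qs {P} → Negs (whynots Σ qs) P → All (λ q → s ≼ proj₁ q) qs →
    ∃ λ rs → P ≡ bangs Σ rs × All (λ r → s ≼ proj₁ r) rs
  negs-whynots []             []             []           = [] , refl , []
  negs-whynots ((t , A) ∷ qs) (neg-! {A = X} n ∷ ns) (s≼t ∷ s≼qs) with rs , refl , s≼rs ← negs-whynots qs ns s≼qs =
    rs ++ [ t , X ] , sym (map-++ _ rs _) , All.++⁺ s≼rs (s≼t ∷ [])

  Decodable : List (CFm Label) → Set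
  Decodable Γ = All Polarized Γ → Lambek Γ

  decodable-rotate : ∀ Γ₁ Γ₂ → Decodable (Γ₁ ++ Γ₂) → Decodable (Γ₂ ++ Γ₁)
  decodable-rotate Γ₁ Γ₂ dec pols with pols₂ , pols₁ ← All.++⁻ Γ₂ pols =
    lambek-rotate Γ₁ (dec (All.++⁺ pols₁ pols₂))

  decodable-ax : ∀ {A} → Decodable (A ∷ A ᗮ ∷ [])
  decodable-ax (inj₁ (_ , p) ∷ inj₂ (_ , n) ∷ []) with refl ← neg-unique (pos-ᗮ p) n = lambek refl p [] (n ∷ []) ax
  decodable-ax (inj₂ (_ , n) ∷ inj₁ (_ , p) ∷ []) with refl ← pos-unique (neg-ᗮ n) p = lambek refl p (n ∷ []) [] ax
  decodable-ax (inj₁ (_ , p) ∷ inj₁ (_ , p′) ∷ []) = ⊥-elim (pos-neg-disjoint p′ (pos-ᗮ p))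
  decodable-ax (inj₂ (_ , n) ∷ inj₂ (_ , n′) ∷ []) = ⊥-elim (pos-neg-disjoint (neg-ᗮ n) n′)

  decodable-⊗r : ∀ {Γ Δ A B} → Decodable (Γ ++ [ A ]) → Decodable (B ∷ Δ) → Decodable (Γ ++ A ⊗ B ∷ Δ)
  decodable-⊗r {Γ} {Δ} {A} {B} decA decB pols with polsΓ , pol ∷ polsΔ ← All.++⁻ Γ pols with pol
  ... | inj₁ (_ , pos-· pA pB)
    with Pγ , _ , nsΓ , [] , dA ← lambek-at Γ (decA (All.++⁺ polsΓ (inj₁ (_ , pA) ∷ []))) pA
       | Pδ , nsΔ , dB ← lambek-head (decB (inj₁ (_ , pB) ∷ polsΔ)) pB =
    lambek refl (pos-· pA pB) nsΓ nsΔ (→· (castᴸ (++-identityʳ Pγ) dA) dB)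
  ... | inj₂ (_ , neg-∖ nA pB) with Pδ , nsΔ , dB ← lambek-head (decB (inj₁ (_ , pB) ∷ polsΔ)) pB =
    lambek-rotate (A ⊗ B ∷ Δ) (lambek-unfocus (neg-∖ nA pB ∷ nsΔ)
      (lambekWith-map (λ {P₁} {P₂} d → castᴸ (cong (P₁ ++_) (sym (++-assoc Pδ _ P₂))) (∖→ dB d))
        (lambek-focus [ A ] (lambek-rotate Γ (decA (All.++⁺ polsΓ (inj₂ (_ , nA) ∷ [])))) (nA ∷ []))))
  ... | inj₂ (_ , neg-⁄ pA nB)
    with Pγ , _ , nsΓ , [] , dA ← lambek-at Γ (decA (All.++⁺ polsΓ (inj₁ (_ , pA) ∷ []))) pA =
    subst Lambek (++-assoc Γ [ A ⊗ B ] Δ) (lambek-unfocus (negs-∷ʳ nsΓ (neg-⁄ pA nB))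
      (lambekWith-map (⁄→ (castᴸ (++-identityʳ Pγ) dA))
        (lambek-focus [ B ] (decB (inj₂ (_ , nB) ∷ polsΔ)) (nB ∷ []))))

  decodable-⅋r : ∀ {Γ A B} → Decodable (A ∷ B ∷ Γ) → Decodable (A ⅋ B ∷ Γ)
  decodable-⅋r dec (inj₁ (_ , pos-∖ nA pB) ∷ pols)
    with _ , _ , n ∷ [] , nsΓ , d ← lambek-at [ _ ] (dec (inj₂ (_ , nA) ∷ inj₁ (_ , pB) ∷ pols)) pB
    with refl ← neg-unique n nA = lambek refl (pos-∖ nA pB) [] nsΓ (→∖ d)
  decodable-⅋r dec (inj₁ (_ , pos-⁄ pA nB) ∷ pols)
    with _ , n ∷ nsΓ , d ← lambek-head (dec (inj₁ (_ , pA) ∷ inj₂ (_ , nB) ∷ pols)) pA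
    with refl ← neg-unique n nB = lambek refl (pos-⁄ pA nB) [] nsΓ (→⁄ d)
  decodable-⅋r dec (inj₂ (_ , neg-· nA nB) ∷ pols) =
    lambek-unfocus (neg-· nA nB ∷ [])
      (lambekWith-map ·→ (lambek-focus (_ ∷ _ ∷ []) (dec (inj₂ (_ , nA) ∷ inj₂ (_ , nB) ∷ pols)) (nA ∷ nB ∷ [])))

  decodable-&r : ∀ {Γ A B} → Decodable (A ∷ Γ) → Decodable (B ∷ Γ) → Decodable (A & B ∷ Γ)
  decodable-&r decA decB (inj₁ (_ , pos-∧ pA pB) ∷ pols)
    with _ , nsΓ , dA ← lambek-head (decA (inj₁ (_ , pA) ∷ pols)) pA
       | _ , nsΓ′ , dB ← lambek-head (decB (inj₁ (_ , pB) ∷ pols)) pB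
    with refl ← negs-unique nsΓ nsΓ′ = lambek refl (pos-∧ pA pB) [] nsΓ (→∧ dA dB)
  decodable-&r decA decB (inj₂ (_ , neg-∨ nA nB) ∷ pols) =
    lambek-unfocus (neg-∨ nA nB ∷ []) (lambekWith-merge ∨→
      (lambek-focus [ _ ] (decA (inj₂ (_ , nA) ∷ pols)) (nA ∷ []))
      (lambek-focus [ _ ] (decB (inj₂ (_ , nB) ∷ pols)) (nB ∷ [])))

  decodable-⊕r₁ : ∀ {Γ A B} → Decodable (A ∷ Γ) → Decodable (A ⊕ B ∷ Γ)
  decodable-⊕r₁ dec (inj₁ (_ , pos-∨ pA pB) ∷ pols) with _ , nsΓ , d ← lambek-head (dec (inj₁ (_ , pA) ∷ pols)) pA =
    lambek refl (pos-∨ pA pB) [] nsΓ (→∨₁ d)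
  decodable-⊕r₁ dec (inj₂ (_ , neg-∧ nA nB) ∷ pols) =
    lambek-unfocus (neg-∧ nA nB ∷ []) (lambekWith-map ∧₁→ (lambek-focus [ _ ] (dec (inj₂ (_ , nA) ∷ pols)) (nA ∷ [])))

  decodable-⊕r₂ : ∀ {Γ A B} → Decodable (B ∷ Γ) → Decodable (A ⊕ B ∷ Γ)
  decodable-⊕r₂ dec (inj₁ (_ , pos-∨ pA pB) ∷ pols) with _ , nsΓ , d ← lambek-head (dec (inj₁ (_ , pB) ∷ pols)) pB =
    lambek refl (pos-∨ pA pB) [] nsΓ (→∨₂ d)
  decodable-⊕r₂ dec (inj₂ (_ , neg-∧ nA nB) ∷ pols) =
    lambek-unfocus (neg-∧ nA nB ∷ []) (lambekWith-map ∧₂→ (lambek-focus [ _ ] (dec (inj₂ (_ , nB) ∷ pols)) (nB ∷ [])))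

  decodable-𝟏r : Decodable [ 𝟏 ]
  decodable-𝟏r (inj₁ (_ , pos-𝟏) ∷ []) = lambek refl pos-𝟏 [] [] →𝟏

  decodable-⊥r : ∀ {Γ} → Decodable Γ → Decodable (⊥ ∷ Γ)
  decodable-⊥r dec (inj₂ (_ , neg-𝟏) ∷ pols) =
    lambek-unfocus (neg-𝟏 ∷ []) (lambekWith-map 𝟏→ (lambek-focus [] (dec pols) []))

  decodable-⊤r : ∀ {Γ} → Decodable (⊤ ∷ Γ)
  decodable-⊤r (inj₁ (_ , ()) ∷ _)
  decodable-⊤r (inj₂ (_ , ()) ∷ _)

  decodable-!r : ∀ {qs s B} → All (λ q → s ≼ proj₁ q) qs → Decodable (B ∷ whynots Σ qs) →
    Decodable (‼ s [ B ] ∷ whynots Σ qs)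
  decodable-!r {qs} s≼qs dec (inj₁ (_ , pos-! p) ∷ pols)
    with _ , ns , d ← lambek-head (dec (inj₁ (_ , p) ∷ pols)) p
    with rs , refl , s≼rs ← negs-whynots qs ns s≼qs = lambek refl (pos-! p) [] ns (→! s≼rs d)

  decodable-?r : ∀ {Γ s A} → Decodable (A ∷ Γ) → Decodable (⁇ s [ A ] ∷ Γ)
  decodable-?r dec (inj₂ (_ , neg-! n) ∷ pols) =
    lambek-unfocus (neg-! n ∷ []) (lambekWith-map !→ (lambek-focus [ _ ] (dec (inj₂ (_ , n) ∷ pols)) (n ∷ [])))

  decodable-weak : ∀ {Γ s A} → W s → Decodable Γ → Decodable (⁇ s [ A ] ∷ Γ)
  decodable-weak w dec (inj₂ (_ , neg-! n) ∷ pols) =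
    lambek-unfocus (neg-! n ∷ []) (lambekWith-map (weak w) (lambek-focus [] (dec pols) []))

  decodable-ex : ∀ {Γ Δ s A} → E s → Decodable (Γ ++ ⁇ s [ A ] ∷ Δ) → Decodable (⁇ s [ A ] ∷ Γ ++ Δ)
  decodable-ex {Γ} {Δ} {s} {A} e dec (inj₂ (_ , neg-! n) ∷ pols) with polsΓ , polsΔ ← All.++⁻ Γ pols
    with lambek {N₁} {b} {P₁ = P₁} {P₂} eq p ns₁ ns₂ d ← dec (All.++⁺ polsΓ (inj₂ (_ , neg-! n) ∷ polsΔ))
    with negative-position (sym eq) p (neg-! n)
  ... | inj₁ (M , refl , refl) with Pm , _ , refl , nsM , neg-! n′ ∷ nsΔ ← negs-++⁻ M {⁇ s [ A ] ∷ Δ} ns₂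
    with refl ← neg-unique n′ n =
    lambek-unfocus (neg-! n ∷ []) (lambekWith (++-assoc N₁ (b ∷ M) Δ) p ns₁ (negs-++⁺ nsM nsΔ)
      (ex₁ e (castᴸ (cong (P₁ ++_) (++-assoc _ [ _ ] Pm)) d)))
  ... | inj₂ (M , refl , refl) with Pγ , _ , refl , nsΓ , _∷_ {X = Y} {Xs = Pm} (neg-! n′) nsM ← negs-++⁻ Γ {⁇ s [ A ] ∷ M} ns₁
    with refl ← neg-unique n′ n =
    lambek-unfocus (neg-! n ∷ []) (lambekWith (sym (++-assoc Γ M _)) p (negs-++⁺ nsΓ nsM) ns₂
      (castᴸ (sym (++-assoc Pm Pγ (Y ∷ P₂))) (ex₂ {Γ₁ = Pm} e (castᴸ (++-assoc₄ Pm [ Y ] Pγ P₂) d))))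

  decodable-ncontr : ∀ {Γ Δ s A} → C s → Decodable (⁇ s [ A ] ∷ Γ ++ ⁇ s [ A ] ∷ Δ) →
    Decodable (⁇ s [ A ] ∷ Γ ++ Δ)
  decodable-ncontr {Γ} {Δ} {s} {A} c dec (inj₂ (_ , neg-! n) ∷ pols) with polsΓ , polsΔ ← All.++⁻ Γ pols
    with lambekWith {V₁} {b} {P₁ = P₁} {P₂} eq p ns₁ ns₂ d ←
           lambek-focus [ _ ] (dec (inj₂ (_ , neg-! n) ∷ All.++⁺ polsΓ (inj₂ (_ , neg-! n) ∷ polsΔ))) (neg-! n ∷ [])
    with negative-position (sym eq) p (neg-! n)
  ... | inj₁ (M , refl , refl) with Pm , _ , refl , nsM , neg-! n′ ∷ nsΔ ← negs-++⁻ M {⁇ s [ A ] ∷ Δ} ns₂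
    with refl ← neg-unique n′ n =
    lambek-unfocus (neg-! n ∷ []) (lambekWith (++-assoc V₁ (b ∷ M) Δ) p ns₁ (negs-++⁺ nsM nsΔ)
      (ncontr₁ c (castᴸ (cong (λ P → P₁ ++ _ ∷ P) (++-assoc _ [ _ ] Pm)) d)))
  ... | inj₂ (M , refl , refl) with Pγ , _ , refl , nsΓ , _∷_ {X = Y} {Xs = Pm} (neg-! n′) nsM ← negs-++⁻ Γ {⁇ s [ A ] ∷ M} ns₁
    with refl ← neg-unique n′ n =
    lambek-unfocus (neg-! n ∷ []) (lambekWith (sym (++-assoc Γ M _)) p (negs-++⁺ nsΓ nsM) ns₂
      (castᴸ (sym (++-assoc Pm Pγ (Y ∷ P₂))) (ncontr₂ {Γ₁ = Pm} c (castᴸ (++-assoc₄ Pm [ Y ] Pγ (Y ∷ P₂)) d))))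

  decodable : ∀ {Γ} → SCLL Σ false Γ → Decodable Γ
  decodable (rot {Γ₁ = Γ₁} {Γ₂} d) = decodable-rotate Γ₁ Γ₂ (decodable d)
  decodable ax                     = decodable-ax
  decodable (⊗r d e)               = decodable-⊗r (decodable d) (decodable e)
  decodable (⅋r d)                 = decodable-⅋r (decodable d)
  decodable (&r d e)               = decodable-&r (decodable d) (decodable e)
  decodable (⊕r₁ d)                = decodable-⊕r₁ (decodable d)
  decodable (⊕r₂ d)                = decodable-⊕r₂ (decodable d)
  decodable 𝟏r                     = decodable-𝟏r
  decodable (⊥r d)                 = decodable-⊥r (decodable d)
  decodable ⊤r                     = decodable-⊤r
  decodable (!r s≼qs d)            = decodable-!r s≼qs (decodable d)
  decodable (?r d)                 = decodable-?r (decodable d)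
  decodable (weak w d)             = decodable-weak w (decodable d)
  decodable (ncontr c d)           = decodable-ncontr c (decodable d)
  decodable (ex e d)               = decodable-ex e (decodable d)

  conservativity : ∀ {Π B} → SCLL Σ false (⟦ Π ⟧ᗮ ++ [ ⟦ B ⟧ ]) → Π ⊢ᴸ B
  conservativity {Π} {B} d
    with _ , _ , ns , [] , d′ ← lambek-at ⟦ Π ⟧ᗮ (decodable d (translation-polarized Π B)) (pos-⟦⟧ B)
    with refl ← negs-unique ns (negs-⟦⟧ᗮ Π) = castᴸ (++-identityʳ Π) d′

theorem2 : (Σ : SubexpSig) (Π : List (LFm (SubexpSig.Label Σ))) (B : LFm (SubexpSig.Label Σ)) →
    (SMALC Σ false Π B ⇔ SMALC Σ true Π B)
    × (SMALC Σ true Π B ⇔ SCLL Σ true (⟦ Π ⟧ᗮ ++ [ ⟦ B ⟧ ]))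
    × (SCLL Σ true (⟦ Π ⟧ᗮ ++ [ ⟦ B ⟧ ]) ⇔ SCLL Σ false (⟦ Π ⟧ᗮ ++ [ ⟦ B ⟧ ]))
theorem2 Σ Π B =
  mk⇔ SMALC-withCut (conservativity ∘ cutElimination ∘ ⟦_⟧ᴰ) ,
  mk⇔ ⟦_⟧ᴰ (SMALC-withCut ∘ conservativity ∘ cutElimination) ,
  mk⇔ cutElimination SCLL-withCut
  where
  open Translation Σ using (⟦_⟧ᴰ)
  open CutElimination Σ using (cutElimination)
  open Conservativity Σ using (conservativity)
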